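{- There is no $4$-$\gamma_t$-critical graph $G$ of order $\Delta(G)+4$ with minimum degree $\delta(G)\ge 2$ and maximum degree $\Delta(G)\in\{3,5,7\}$.
   Context: For a graph $G$, a set $S\subseteq V(G)$ is a total dominating set if every vertex of $G$ is adjacent to some vertex of $S$; $\gamma_t(G)$ is the minimum size of such a set. A leaf is a vertex of degree one. A graph $G$ with no isolated vertex is $\gamma_t$-critical if $\gamma_t(G-v)<\gamma_t(G)$ for every vertex $v$ not adjacent to a leaf, and $m$-$\gamma_t$-critical if also $\gamma_t(G)=m$. $\Delta(G)$ and $\delta(G)$ are the maximum and minimum degrees. -}

module Defs where

open import Data.Nat using (ℕ; _<_; _≤_)
open import Data.Fin using (Fin)
open import Data.Fin.Subset using (Subset; _∈_; _∉_; ∣_∣)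
open import Data.Product using (Σ; ∃; _×_)
open import Relation.Nullary using (¬_; Dec)
open import Relation.Binary.PropositionalEquality using (_≡_)
open import Data.List using (List; length; filter)
open import Data.List.Base using ()
open import Data.Fin.Base using ()
open import Data.List using (allFin)

record Graph (n : ℕ) : Set₁ where
  field
    Adj   : Fin n → Fin n → Set
    adj?  : ∀ u v → Dec (Adj u v)
    sym   : ∀ {u v} → Adj u v → Adj v u
    irrefl : ∀ {u} → ¬ Adj u u
open Graph public

degree : ∀ {n} → Graph n → Fin n → ℕ
degree G v = length (filter (adj? G v) (allFin _))

MaxDegree : ∀ {n} → Graph n → ℕ → Set
MaxDegree G D = (∃ λ v → degree G v ≡ D) × (∀ v → degree G v ≤ D)

MinDegreeAtLeast : ∀ {n} → Graph n → ℕ → Set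
MinDegreeAtLeast G k = ∀ v → k ≤ degree G v

NoIsolated : ∀ {n} → Graph n → Set
NoIsolated G = ∀ v → ∃ λ u → Adj G v u

IsTDS : ∀ {n} → Graph n → Subset n → Set
IsTDS G S = ∀ v → ∃ λ u → u ∈ S × Adj G v u

γt≡ : ∀ {n} → Graph n → ℕ → Set
γt≡ G m = (∃ λ S → IsTDS G S × ∣ S ∣ ≡ m) × (∀ S → IsTDS G S → m ≤ ∣ S ∣)

IsTDS-del : ∀ {n} → Graph n → Fin n → Subset n → Set
IsTDS-del G v S = v ∉ S × (∀ w → ¬ w ≡ v → ∃ λ u → u ∈ S × Adj G w u)

Leaf : ∀ {n} → Graph n → Fin n → Set
Leaf G v = degree G v ≡ 1

Critical : ∀ {n} → Graph n → ℕ → Set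
Critical G m = NoIsolated G × γt≡ G m ×
  (∀ v → ¬ (∃ λ u → Adj G v u × Leaf G u) →
     ∃ λ S → IsTDS-del G v S × ∣ S ∣ < m)

module Submission where

-- Let u have degree Δ = D; as n = D + 4, exactly three vertices a, b, c lie outside N[u]. Since
-- δ ≥ 2 no vertex is adjacent to a leaf, so for every vertex v some set of at most three vertices
-- outside N[v] totally dominates G - v, while no three vertices totally dominate G. For v = u that
-- set lies in {a, b, c}, which forces G - N[u] to be a path a - b - c with N(b) = {a, c}, and splits
-- N(u) into A = N(u) ∩ N(a) and C = N(u) ∩ N(c). Excluding the dominating sets {a, b, x} and
-- {a, x, y}, and using criticality at every x ∈ A (and symmetrically at C), constrains the edges
-- inside N(u). These constraints are propositional formulas in the edge variables of the D
-- vertices of N(u), and for D ∈ {3, 5, 7} and every split D = |A| + |C| they are unsatisfiable,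
-- as certified by explicit refutation trees.

open import Defs
open import Data.Nat using (ℕ; _+_)
open import Data.Product using (_×_; _,_)
open import Data.Sum using (_⊎_)
open import Relation.Nullary using (¬_)
open import Relation.Binary.PropositionalEquality using (_≡_)
import Relation.Binary.PropositionalEquality as ≡

module Finite where
  import Level
  open import Data.Nat using (ℕ; zero; suc; _+_; _≤_; s≤s)
  open import Data.Nat.Properties using (+-suc)
  open import Data.Bool using (true; false)
  open import Data.Fin using (Fin; zero; suc)
  open import Data.Fin.Subset using (Subset; ⁅_⁆; _∪_; ∣_∣) renaming (_∈_ to _∈ₛ_)
  open import Data.Fin.Subset.Properties using (∪-identityˡ; ∣p∣≤∣x∷p∣)
  open import Data.Vec using ([]; _∷_; here; there)
  open import Data.List using (List; []; _∷_; _++_; map; length; filter; upTo; applyUpTo)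
  open import Data.List.Properties using (length-map; map-upTo; map-applyUpTo)
  import Data.List.Relation.Unary.All as All
  open import Data.List.Relation.Unary.AllPairs using (AllPairs; _∷_)
  open import Data.List.Relation.Unary.Any using (here; there)
  open import Data.List.Membership.Propositional using (_∈_)
  open import Data.List.Membership.Propositional.Properties using (∈-map⁺; ∈-map⁻)
  open import Data.Product using (_×_; _,_; ∃-syntax; map₂)
  open import Data.Sum using (_⊎_; inj₁; inj₂)
  open import Data.Empty using (⊥-elim)
  open import Function using (_∘_)
  open import Relation.Nullary using (¬?; yes; no)
  open import Relation.Unary using (Pred; Decidable)
  open import Relation.Binary.PropositionalEquality as ≡ using (_≡_; _≢_; refl; cong; trans)

  ∣⁅x⁆∪p∣≤1+∣p∣ : ∀ {n} (x : Fin n) (p : Subset n) → ∣ ⁅ x ⁆ ∪ p ∣ ≤ suc ∣ p ∣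
  ∣⁅x⁆∪p∣≤1+∣p∣ zero    (b ∷ p) rewrite ∪-identityˡ p = s≤s (∣p∣≤∣x∷p∣ b p)
  ∣⁅x⁆∪p∣≤1+∣p∣ (suc x) (true ∷ p)  = s≤s (∣⁅x⁆∪p∣≤1+∣p∣ x p)
  ∣⁅x⁆∪p∣≤1+∣p∣ (suc x) (false ∷ p) = ∣⁅x⁆∪p∣≤1+∣p∣ x p

  elements : ∀ {n} → Subset n → List (Fin n)
  elements []          = []
  elements (true ∷ p)  = zero ∷ map suc (elements p)
  elements (false ∷ p) = map suc (elements p)

  length-elements : ∀ {n} (p : Subset n) → length (elements p) ≡ ∣ p ∣
  length-elements []          = refl
  length-elements (true ∷ p)  = cong suc (trans (length-map suc (elements p)) (length-elements p))
  length-elements (false ∷ p) = trans (length-map suc (elements p)) (length-elements p)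

  ∈-elements⁺ : ∀ {n} {x : Fin n} {p} → x ∈ₛ p → x ∈ elements p
  ∈-elements⁺ {p = true ∷ p}  here      = here refl
  ∈-elements⁺ {p = true ∷ p}  (there q) = there (∈-map⁺ suc (∈-elements⁺ q))
  ∈-elements⁺ {p = false ∷ p} (there q) = ∈-map⁺ suc (∈-elements⁺ q)

  ∈-elements⁻ : ∀ {n} {x : Fin n} {p} → x ∈ elements p → x ∈ₛ p
  ∈-elements⁻ {p = true ∷ p} (here refl) = here
  ∈-elements⁻ {p = true ∷ p} (there m) with ∈-map⁻ suc m
  ... | _ , m′ , refl = there (∈-elements⁻ m′)
  ∈-elements⁻ {p = false ∷ p} m with ∈-map⁻ suc m
  ... | _ , m′ , refl = there (∈-elements⁻ m′)

  length-filter-∁ : ∀ {A : Set} {P : Pred A Level.zero} (P? : Decidable P) (xs : List A) →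
    length (filter P? xs) + length (filter (λ x → ¬? (P? x)) xs) ≡ length xs
  length-filter-∁ P? [] = refl
  length-filter-∁ P? (x ∷ xs) with P? x
  ... | yes _ = cong suc (length-filter-∁ P? xs)
  ... | no _  = trans (+-suc _ _) (cong suc (length-filter-∁ P? xs))

  infix 4 _∈₃_
  _∈₃_ : ∀ {A : Set} → A → A × A × A → Set
  x ∈₃ (s₁ , s₂ , s₃) = x ≡ s₁ ⊎ x ≡ s₂ ⊎ x ≡ s₃

  -- The elements s₁, s₂, s₃ need not be distinct.
  record Cover₃ {A : Set} (P : A → Set) : Set where
    field
      s₁ s₂ s₃ : A
      members  : ∀ {x} → x ∈₃ (s₁ , s₂ , s₃) → P x
      covers   : ∀ {x} → P x → x ∈₃ (s₁ , s₂ , s₃)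

  short-list-cover₃ : ∀ {A : Set} (L : List A) {x} → length L ≤ 3 → x ∈ L → Cover₃ (_∈ L)
  short-list-cover₃ (a ∷ []) _ _ = record
    { s₁ = a ; s₂ = a ; s₃ = a
    ; members = λ { (inj₁ refl) → here refl ; (inj₂ (inj₁ refl)) → here refl
                  ; (inj₂ (inj₂ refl)) → here refl }
    ; covers  = λ { (here e) → inj₁ e } }
  short-list-cover₃ (a ∷ b ∷ []) _ _ = record
    { s₁ = a ; s₂ = b ; s₃ = b
    ; members = λ { (inj₁ refl) → here refl ; (inj₂ (inj₁ refl)) → there (here refl)
                  ; (inj₂ (inj₂ refl)) → there (here refl) }
    ; covers  = λ { (here e) → inj₁ e ; (there (here e)) → inj₂ (inj₁ e) } }
  short-list-cover₃ (a ∷ b ∷ c ∷ []) _ _ = record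
    { s₁ = a ; s₂ = b ; s₃ = c
    ; members = λ { (inj₁ refl) → here refl ; (inj₂ (inj₁ refl)) → there (here refl)
                  ; (inj₂ (inj₂ refl)) → there (there (here refl)) }
    ; covers  = λ { (here e) → inj₁ e ; (there (here e)) → inj₂ (inj₁ e)
                  ; (there (there (here e))) → inj₂ (inj₂ e) } }
  short-list-cover₃ (_ ∷ _ ∷ _ ∷ _ ∷ _) (s≤s (s≤s (s≤s ()))) _

  lookupOr : ∀ {A : Set} → A → List A → ℕ → A
  lookupOr d []       _       = d
  lookupOr d (x ∷ xs) zero    = x
  lookupOr d (x ∷ xs) (suc i) = lookupOr d xs i

  module _ {A : Set} (d : A) where

    applyUpTo-lookupOr : ∀ L → applyUpTo (lookupOr d L) (length L) ≡ L
    applyUpTo-lookupOr []      = refl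
    applyUpTo-lookupOr (x ∷ L) = cong (x ∷_) (applyUpTo-lookupOr L)

    map-lookupOr-prefix : ∀ L M → map (lookupOr d (L ++ M)) (upTo (length L)) ≡ L
    map-lookupOr-prefix L M = trans (map-upTo _ (length L)) (prefix L)
      where
      prefix : ∀ K → applyUpTo (lookupOr d (K ++ M)) (length K) ≡ K
      prefix []      = refl
      prefix (x ∷ K) = cong (x ∷_) (prefix K)

    map-lookupOr-suffix : ∀ L M → map (lookupOr d (L ++ M)) (applyUpTo (length L +_) (length M)) ≡ M
    map-lookupOr-suffix L M = trans (map-applyUpTo _ _ (length M)) (suffix L)
      where
      suffix : ∀ K → applyUpTo (λ j → lookupOr d (K ++ M) (length K + j)) (length M) ≡ M
      suffix []      = applyUpTo-lookupOr M
      suffix (_ ∷ K) = suffix K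

  selections : ∀ {X : Set} → List X → List (X × List X)
  selections []       = []
  selections (x ∷ xs) = (x , xs) ∷ map (map₂ (x ∷_)) (selections xs)

  module _ {X : Set} where

    selection-∈ : ∀ {L : List X} {x r} → (x , r) ∈ selections L → x ∈ L
    selection-∈ {_ ∷ _} (here refl) = here refl
    selection-∈ {_ ∷ _} (there s) with ∈-map⁻ _ s
    ... | _ , s′ , refl = there (selection-∈ s′)

    selection-⊆ : ∀ {L : List X} {x r z} → (x , r) ∈ selections L → z ∈ r → z ∈ L
    selection-⊆ {_ ∷ _} (here refl) z∈r = there z∈r
    selection-⊆ {_ ∷ _} (there s) z∈r with ∈-map⁻ _ s
    selection-⊆ {_ ∷ _} (there s) (here refl)  | _ , s′ , refl = here refl
    selection-⊆ {_ ∷ _} (there s) (there z∈r) | _ , s′ , refl = there (selection-⊆ s′ z∈r)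

    selection-exists : ∀ {L : List X} {x} → x ∈ L → ∃[ r ] (x , r) ∈ selections L
    selection-exists {y ∷ ys} (here refl) = ys , here refl
    selection-exists {y ∷ ys} (there x∈ys) with selection-exists x∈ys
    ... | r , s = y ∷ r , there (∈-map⁺ _ s)

  module _ {X V : Set} (f : X → V) where

    selection-rest : ∀ {L : List X} {x r z} → (x , r) ∈ selections L → z ∈ L → f z ≢ f x → z ∈ r
    selection-rest {_ ∷ _} (here refl) (here refl) fz≢fx = ⊥-elim (fz≢fx refl)
    selection-rest {_ ∷ _} (here refl) (there z∈L) _ = z∈L
    selection-rest {_ ∷ _} (there s) z∈L fz≢fx with ∈-map⁻ _ s
    selection-rest {_ ∷ _} (there s) (here refl)  _     | _ , s′ , refl = here refl
    selection-rest {_ ∷ _} (there s) (there z∈L) fz≢fx | _ , s′ , refl =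
      there (selection-rest s′ z∈L fz≢fx)

    selection-distinct : ∀ {L : List X} {x r z} → AllPairs (λ i j → f i ≢ f j) L →
      (x , r) ∈ selections L → z ∈ r → f z ≢ f x
    selection-distinct {_ ∷ _} (d ∷ _) (here refl) z∈r = All.lookup d z∈r ∘ ≡.sym
    selection-distinct {_ ∷ _} (d ∷ ds) (there s) z∈r with ∈-map⁻ _ s
    selection-distinct {_ ∷ _} (d ∷ ds) (there s) (here refl)  | _ , s′ , refl =
      All.lookup d (selection-∈ s′)
    selection-distinct {_ ∷ _} (d ∷ ds) (there s) (there z∈r) | _ , s′ , refl =
      selection-distinct ds s′ z∈r

module Formulas where
  open import Data.Nat using (ℕ; zero; suc; _≟_)
  open import Data.Bool using (Bool; true; false; not; _∧_; _∨_; T)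
  open import Data.Bool.Properties using (T-∧; T-∨; T?)
  open import Data.Maybe using (Maybe; just; nothing)
  open import Data.List using (List; []; _∷_; map)
  open import Data.List.Relation.Unary.All using (All; []; _∷_)
  import Data.List.Relation.Unary.All as All
  open import Data.List.Relation.Unary.Any using (here; there)
  open import Data.List.Membership.Propositional using (_∈_)
  open import Data.Product using (_×_; _,_)
  import Data.Sum
  open import Data.Sum using (_⊎_; inj₁; inj₂)
  open import Data.Empty using (⊥; ⊥-elim)
  open import Data.Unit using (⊤; tt)
  open import Function using (_∘_; Equivalence)
  open import Relation.Binary using (Decidable)
  open import Relation.Nullary using (¬_; Dec; yes; no)
  open import Relation.Nullary.Decidable
    using (decidable-stable; isYes; toWitness; fromWitness; _×-dec_; _⊎-dec_)
  open import Relation.Binary.PropositionalEquality as ≡ using (_≡_; refl; trans)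

  data Formula (X : Set) : Set where
    edge : X → X → Formula X
    neg  : Formula X → Formula X
    ⋀    : List (Formula X) → Formula X
    ⋁    : List (Formula X) → Formula X

  EdgeAssignment : Set → Set
  EdgeAssignment X = X → X → Bool

  mutual
    eval : ∀ {X} → EdgeAssignment X → Formula X → Bool
    eval ρ (edge x y) = ρ x y
    eval ρ (neg φ)    = not (eval ρ φ)
    eval ρ (⋀ φs)     = evalAll ρ φs
    eval ρ (⋁ φs)     = evalAny ρ φs

    evalAll : ∀ {X} → EdgeAssignment X → List (Formula X) → Bool
    evalAll ρ []       = true
    evalAll ρ (φ ∷ φs) = eval ρ φ ∧ evalAll ρ φs

    evalAny : ∀ {X} → EdgeAssignment X → List (Formula X) → Bool
    evalAny ρ []       = false
    evalAny ρ (φ ∷ φs) = eval ρ φ ∨ evalAny ρ φs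

  Satisfies : ∀ {X} → EdgeAssignment X → List (Formula X) → Set
  Satisfies ρ = All (T ∘ eval ρ)

  Symmetric : ∀ {X} → EdgeAssignment X → Set
  Symmetric ρ = ∀ i j → ρ i j ≡ ρ j i

  PartialAssignment : Set
  PartialAssignment = List (ℕ × ℕ × Bool)

  SameEdge : ℕ → ℕ → ℕ → ℕ → Set
  SameEdge k l i j = (k ≡ i × l ≡ j) ⊎ (k ≡ j × l ≡ i)

  sameEdge? : ∀ k l i j → Dec (SameEdge k l i j)
  sameEdge? k l i j = (k ≟ i ×-dec l ≟ j) ⊎-dec (k ≟ j ×-dec l ≟ i)

  lookupEdge : ℕ → ℕ → PartialAssignment → Maybe Bool
  lookupEdge k l []                = nothing
  lookupEdge k l ((i , j , b) ∷ σ) with sameEdge? k l i j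
  ... | yes _ = just b
  ... | no _  = lookupEdge k l σ

  not₃ : Maybe Bool → Maybe Bool
  not₃ (just b) = just (not b)
  not₃ nothing  = nothing

  _∧₃_ : Maybe Bool → Maybe Bool → Maybe Bool
  just false ∧₃ _          = just false
  just true  ∧₃ m          = m
  nothing    ∧₃ just false = just false
  nothing    ∧₃ _          = nothing

  _∨₃_ : Maybe Bool → Maybe Bool → Maybe Bool
  just true  ∨₃ _         = just true
  just false ∨₃ m         = m
  nothing    ∨₃ just true = just true
  nothing    ∨₃ _         = nothing

  mutual
    eval₃ : PartialAssignment → Formula ℕ → Maybe Bool
    eval₃ σ (edge i j) = lookupEdge i j σ
    eval₃ σ (neg φ)    = not₃ (eval₃ σ φ)
    eval₃ σ (⋀ φs)     = evalAll₃ σ φs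
    eval₃ σ (⋁ φs)     = evalAny₃ σ φs

    evalAll₃ : PartialAssignment → List (Formula ℕ) → Maybe Bool
    evalAll₃ σ []       = just true
    evalAll₃ σ (φ ∷ φs) = eval₃ σ φ ∧₃ evalAll₃ σ φs

    evalAny₃ : PartialAssignment → List (Formula ℕ) → Maybe Bool
    evalAny₃ σ []       = just false
    evalAny₃ σ (φ ∷ φs) = eval₃ σ φ ∨₃ evalAny₃ σ φs

  _⊑_ : Maybe Bool → Bool → Set
  just b  ⊑ c = b ≡ c
  nothing ⊑ c = ⊤

  not₃-⊑ : ∀ {m b} → m ⊑ b → not₃ m ⊑ not b
  not₃-⊑ {just b}  refl = refl
  not₃-⊑ {nothing} _    = tt

  ∧₃-⊑ : ∀ {m b m′ b′} → m ⊑ b → m′ ⊑ b′ → (m ∧₃ m′) ⊑ (b ∧ b′)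
  ∧₃-⊑ {just false}                   refl _    = refl
  ∧₃-⊑ {just true}                    refl q    = q
  ∧₃-⊑ {nothing} {b} {just false}     _    refl with b
  ... | true  = refl
  ... | false = refl
  ∧₃-⊑ {nothing} {m′ = just true}     _    _    = tt
  ∧₃-⊑ {nothing} {m′ = nothing}       _    _    = tt

  ∨₃-⊑ : ∀ {m b m′ b′} → m ⊑ b → m′ ⊑ b′ → (m ∨₃ m′) ⊑ (b ∨ b′)
  ∨₃-⊑ {just true}                    refl _    = refl
  ∨₃-⊑ {just false}                   refl q    = q
  ∨₃-⊑ {nothing} {b} {just true}      _    refl with b
  ... | true  = refl
  ... | false = refl
  ∨₃-⊑ {nothing} {m′ = just false}    _    _    = tt
  ∨₃-⊑ {nothing} {m′ = nothing}       _    _    = tt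

  record _Extends_ (ρ : EdgeAssignment ℕ) (σ : PartialAssignment) : Set where
    constructor extends
    field lookupEdge-agrees : ∀ i j b → lookupEdge i j σ ≡ just b → ρ i j ≡ b
  open _Extends_

  module _ (ρ : EdgeAssignment ℕ) where

    lookupEdge-⊑ : ∀ {σ} → ρ Extends σ → ∀ i j → lookupEdge i j σ ⊑ ρ i j
    lookupEdge-⊑ {σ} ext i j with lookupEdge i j σ in e
    ... | just b  = ≡.sym (lookupEdge-agrees ext i j b e)
    ... | nothing = tt

    mutual
      eval₃-⊑ : ∀ {σ} → ρ Extends σ → ∀ φ → eval₃ σ φ ⊑ eval ρ φ
      eval₃-⊑ ext (edge i j) = lookupEdge-⊑ ext i j
      eval₃-⊑ ext (neg φ)    = not₃-⊑ (eval₃-⊑ ext φ)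
      eval₃-⊑ ext (⋀ φs)     = evalAll₃-⊑ ext φs
      eval₃-⊑ ext (⋁ φs)     = evalAny₃-⊑ ext φs

      evalAll₃-⊑ : ∀ {σ} → ρ Extends σ → ∀ φs → evalAll₃ σ φs ⊑ evalAll ρ φs
      evalAll₃-⊑ ext []       = refl
      evalAll₃-⊑ ext (φ ∷ φs) = ∧₃-⊑ (eval₃-⊑ ext φ) (evalAll₃-⊑ ext φs)

      evalAny₃-⊑ : ∀ {σ} → ρ Extends σ → ∀ φs → evalAny₃ σ φs ⊑ evalAny ρ φs
      evalAny₃-⊑ ext []       = refl
      evalAny₃-⊑ ext (φ ∷ φs) = ∨₃-⊑ (eval₃-⊑ ext φ) (evalAny₃-⊑ ext φs)

    extends-[] : ρ Extends []
    extends-[] = extends λ _ _ _ ()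

    extends-∷ : ∀ {σ i j b} → Symmetric ρ → ρ i j ≡ b → ρ Extends σ →
      ρ Extends ((i , j , b) ∷ σ)
    extends-∷ {σ} {i} {j} {b} ρ-sym ρij ext = extends agrees
      where
      agrees : ∀ k l c → lookupEdge k l ((i , j , b) ∷ σ) ≡ just c → ρ k l ≡ c
      agrees k l c e with sameEdge? k l i j
      agrees k l c refl | yes (inj₁ (refl , refl)) = ρij
      agrees k l c refl | yes (inj₂ (refl , refl)) = trans (ρ-sym j i) ρij
      agrees k l c e    | no _                     = lookupEdge-agrees ext k l c e

  -- A refutation tree branches on edge variables until, at each leaf, the formula with the given
  -- index evaluates to false under the accumulated partial assignment.
  data Refutation : Set where
    falsify : ℕ → Refutation
    branch  : ℕ → ℕ → Refutation → Refutation → Refutation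

  -- Out of range, the junk formula ⋀ [] is true, so it can never be falsified.
  formulaAt : ℕ → List (Formula ℕ) → Formula ℕ
  formulaAt _       []       = ⋀ []
  formulaAt zero    (φ ∷ _)  = φ
  formulaAt (suc k) (_ ∷ φs) = formulaAt k φs

  isFalse : Maybe Bool → Bool
  isFalse (just false) = true
  isFalse _            = false

  refutes : List (Formula ℕ) → PartialAssignment → Refutation → Bool
  refutes φs σ (falsify k)    = isFalse (eval₃ σ (formulaAt k φs))
  refutes φs σ (branch i j t f) =
    refutes φs ((i , j , true) ∷ σ) t ∧ refutes φs ((i , j , false) ∷ σ) f

  module _ (ρ : EdgeAssignment ℕ) where

    formulaAt-satisfied : ∀ {φs} k → Satisfies ρ φs → T (eval ρ (formulaAt k φs))
    formulaAt-satisfied k       []       = tt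
    formulaAt-satisfied zero    (p ∷ _)  = p
    formulaAt-satisfied (suc k) (_ ∷ ps) = formulaAt-satisfied k ps

    isFalse-⊑ : ∀ {m b} → T (isFalse m) → m ⊑ b → ¬ T b
    isFalse-⊑ {just false} _ refl ()

    refutes-sound : ∀ {φs σ} r → Symmetric ρ → ρ Extends σ → Satisfies ρ φs →
      ¬ T (refutes φs σ r)
    refutes-sound {φs} (falsify k) ρ-sym ext sat t =
      isFalse-⊑ t (eval₃-⊑ ρ ext (formulaAt k φs)) (formulaAt-satisfied k sat)
    refutes-sound (branch i j r₁ r₂) ρ-sym ext sat t with Equivalence.to T-∧ t | ρ i j in ρij
    ... | t₁ , _ | true  = refutes-sound r₁ ρ-sym (extends-∷ ρ ρ-sym ρij ext) sat t₁
    ... | _ , t₂ | false = refutes-sound r₂ ρ-sym (extends-∷ ρ ρ-sym ρij ext) sat t₂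

  Unsatisfiable : List (Formula ℕ) → Set
  Unsatisfiable φs = ∀ ρ → Symmetric ρ → ¬ Satisfies ρ φs

  refutation-unsatisfiable : ∀ {φs} r → T (refutes φs [] r) → Unsatisfiable φs
  refutation-unsatisfiable r ok ρ ρ-sym sat = refutes-sound ρ r ρ-sym (extends-[] ρ) sat ok

  T-not⁻ : ∀ {b} → T (not b) → ¬ T b
  T-not⁻ {true}  ()
  T-not⁻ {false} _ ()

  T-not⁺ : ∀ {b} → ¬ T b → T (not b)
  T-not⁺ {true}  ¬t = ¬t tt
  T-not⁺ {false} _  = tt

  module Interpretation {X : Set} {_~_ : X → X → Set} (_~?_ : Decidable _~_) where

    mutual
      ⟦_⟧ : Formula X → Set
      ⟦ edge x y ⟧ = x ~ y
      ⟦ neg φ ⟧    = ¬ ⟦ φ ⟧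
      ⟦ ⋀ φs ⟧     = ⟦⋀⟧ φs
      ⟦ ⋁ φs ⟧     = ⟦⋁⟧ φs

      ⟦⋀⟧ : List (Formula X) → Set
      ⟦⋀⟧ []       = ⊤
      ⟦⋀⟧ (φ ∷ φs) = ⟦ φ ⟧ × ⟦⋀⟧ φs

      ⟦⋁⟧ : List (Formula X) → Set
      ⟦⋁⟧ []       = ⊥
      ⟦⋁⟧ (φ ∷ φs) = ⟦ φ ⟧ ⊎ ⟦⋁⟧ φs

    ρ : EdgeAssignment X
    ρ x y = isYes (x ~? y)

    mutual
      eval-sound : ∀ φ → T (eval ρ φ) → ⟦ φ ⟧
      eval-sound (edge x y) = toWitness
      eval-sound (neg φ)    = λ t p → T-not⁻ t (eval-complete φ p)
      eval-sound (⋀ φs)     = evalAll-sound φs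
      eval-sound (⋁ φs)     = evalAny-sound φs

      eval-complete : ∀ φ → ⟦ φ ⟧ → T (eval ρ φ)
      eval-complete (edge x y) = fromWitness
      eval-complete (neg φ)    = λ ¬p → T-not⁺ (¬p ∘ eval-sound φ)
      eval-complete (⋀ φs)     = evalAll-complete φs
      eval-complete (⋁ φs)     = evalAny-complete φs

      evalAll-sound : ∀ φs → T (evalAll ρ φs) → ⟦⋀⟧ φs
      evalAll-sound []       _ = tt
      evalAll-sound (φ ∷ φs) t =
        let p , ps = Equivalence.to T-∧ t in eval-sound φ p , evalAll-sound φs ps

      evalAll-complete : ∀ φs → ⟦⋀⟧ φs → T (evalAll ρ φs)
      evalAll-complete []       _        = tt
      evalAll-complete (φ ∷ φs) (p , ps) =
        Equivalence.from T-∧ (eval-complete φ p , evalAll-complete φs ps)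

      evalAny-sound : ∀ φs → T (evalAny ρ φs) → ⟦⋁⟧ φs
      evalAny-sound (φ ∷ φs) t = Data.Sum.map (eval-sound φ) (evalAny-sound φs) (Equivalence.to T-∨ t)

      evalAny-complete : ∀ φs → ⟦⋁⟧ φs → T (evalAny ρ φs)
      evalAny-complete (φ ∷ φs) p =
        Equivalence.from T-∨ (Data.Sum.map (eval-complete φ) (evalAny-complete φs) p)

    ⟦⟧-stable : ∀ φ → ¬ ¬ ⟦ φ ⟧ → ⟦ φ ⟧
    ⟦⟧-stable φ ¬¬p =
      eval-sound φ (decidable-stable (T? (eval ρ φ)) λ ¬t → ¬¬p (¬t ∘ eval-complete φ))

    ⟦⋀⟧-map⁺ : ∀ {Y : Set} {g : Y → Formula X} {ys} →
      (∀ {y} → y ∈ ys → ⟦ g y ⟧) → ⟦⋀⟧ (map g ys)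
    ⟦⋀⟧-map⁺ {ys = []}     h = tt
    ⟦⋀⟧-map⁺ {ys = y ∷ ys} h = h (here refl) , ⟦⋀⟧-map⁺ (h ∘ there)

    ⟦⋁⟧-map⁺ : ∀ {Y : Set} {g : Y → Formula X} {ys y} →
      y ∈ ys → ⟦ g y ⟧ → ⟦⋁⟧ (map g ys)
    ⟦⋁⟧-map⁺ (here refl) p = inj₁ p
    ⟦⋁⟧-map⁺ (there y∈ys) p = inj₂ (⟦⋁⟧-map⁺ y∈ys p)

    ρ-symmetric : (∀ {x y} → x ~ y → y ~ x) → Symmetric ρ
    ρ-symmetric ~-sym x y with x ~? y | y ~? x
    ... | yes _   | yes _   = refl
    ... | no _    | no _    = refl
    ... | yes xy  | no ¬yx  = ⊥-elim (¬yx (~-sym xy))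
    ... | no ¬xy  | yes yx  = ⊥-elim (¬xy (~-sym yx))

    satisfies : ∀ {φs} → All ⟦_⟧ φs → Satisfies ρ φs
    satisfies = All.map λ {φ} → eval-complete φ

module Encoding where
  open Formulas
  open Finite
    using (selections; selection-∈; selection-⊆; selection-exists; selection-rest; selection-distinct)
  open import Data.Unit using (tt)
  open import Data.List using (List; []; _∷_; map; _++_)
  open import Data.List.Relation.Unary.All using (All)
  import Data.List.Relation.Unary.All as All
  open import Data.List.Relation.Unary.All.Properties using (++⁺; map⁺)
  open import Data.List.Relation.Unary.AllPairs using (AllPairs)
  import Data.List.Relation.Unary.AllPairs.Properties as AllPairs
  open import Data.List.Relation.Unary.Unique.Propositional using (Unique)
  open import Data.List.Membership.Propositional using (_∈_)
  open import Data.List.Membership.Propositional.Properties using (∈-map⁺; ∈-map⁻)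
  open import Data.Product using (_×_; _,_; ∃-syntax)
  import Data.Sum
  open import Data.Sum using (_⊎_; inj₁; inj₂)
  open import Function using (_∘_)
  open import Relation.Binary using (Decidable)
  open import Relation.Binary.PropositionalEquality as ≡ using (_≡_; _≢_; refl)
  open import Relation.Nullary using (¬_)
  open import Relation.Nullary.Decidable using (decidable-stable; _⊎-dec_)

  module _ {V : Set} (_~_ : V → V → Set) (A C : V → Set) where

    -- For x ∈ A these are the two possible shapes {b, c, y} and {c, x′, y} of a total dominating
    -- set of G - x of size 3.
    data Partner (x : V) : Set where
      alone : ∀ {y} → C y → ¬ x ~ y → (∀ {z} → A z → z ≢ x → z ~ y) → Partner x
      via   : ∀ {y x′} → C y → ¬ x ~ y → A x′ → x′ ≢ x → x′ ~ y → ¬ x′ ~ x →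
              (∀ {z} → A z → z ≢ x → z ~ x′ ⊎ z ~ y) → Partner x

    -- With A = N(u) ∩ N(a) and C = N(u) ∩ N(c): neither {a, b, x} nor {a, x, y} totally dominates G,
    -- and G - x has a total dominating set of size 3.
    record Constraints : Set where
      field
        has-non-neighbour : ∀ {x} → A x → ¬ (∀ {y} → C y → x ~ y)
        edge-escapes      : ∀ {x y} → A x → C y → x ~ y →
                            ¬ (∀ {z} → C z → z ≢ y → z ~ x ⊎ z ~ y)
        has-partner       : ∀ {x} → A x → Partner x

  module _ {X : Set} where

    hasNonNeighbour : List X → X → Formula X
    hasNonNeighbour C x = ⋁ (map (λ y → neg (edge x y)) C)

    edgeEscapes : X → X × List X → Formula X
    edgeEscapes x (y , rest) =
      ⋁ (neg (edge x y) ∷ map (λ z → ⋀ (neg (edge z x) ∷ neg (edge z y) ∷ [])) rest)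

    allEdgesEscape : List X → X → Formula X
    allEdgesEscape C x = ⋀ (map (edgeEscapes x) (selections C))

    partnerVia : X → X → X × List X → Formula X
    partnerVia x y (x′ , r′) =
      ⋀ (edge x′ y ∷ neg (edge x′ x)
         ∷ ⋀ (map (λ z → ⋁ (edge z x′ ∷ edge z y ∷ [])) r′) ∷ [])

    partnerAt : X → List X → X → Formula X
    partnerAt x rest y =
      ⋀ (neg (edge x y)
         ∷ ⋁ (⋀ (map (λ z → edge z y) rest) ∷ map (partnerVia x y) (selections rest)) ∷ [])

    hasPartner : List X → X × List X → Formula X
    hasPartner C (x , rest) = ⋁ (map (partnerAt x rest) C)

    sideFormulas : List X → List X → List (Formula X)
    sideFormulas A C =
      map (hasNonNeighbour C) A ++ map (allEdgesEscape C) A ++ map (hasPartner C) (selections A)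

    configurationFormulas : List X → List X → List (Formula X)
    configurationFormulas A C = sideFormulas A C ++ sideFormulas C A

  module Soundness {V : Set} {_~_ : V → V → Set} (_~?_ : Decidable _~_) {X : Set} (f : X → V) where

    open Interpretation {X} {λ i j → f i ~ f j} (λ i j → f i ~? f j) public

    record Enumerates (P : V → Set) (I : List X) : Set where
      field
        ∈⇒P       : ∀ {i} → i ∈ I → P (f i)
        P⇒∈       : ∀ {v} → P v → ∃[ i ] i ∈ I × f i ≡ v
        injective : AllPairs (λ i j → f i ≢ f j) I
    open Enumerates

    enumerates-via-map : ∀ {P : V → Set} {I L} → map f I ≡ L → Unique L →
      (∀ {v} → v ∈ L → P v) → (∀ {v} → P v → v ∈ L) → Enumerates P I
    enumerates-via-map refl unique ∈⇒P P⇒∈ = record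
      { ∈⇒P       = ∈⇒P ∘ ∈-map⁺ f
      ; P⇒∈       = λ Pv → let i , i∈I , e = ∈-map⁻ f (P⇒∈ Pv) in i , i∈I , ≡.sym e
      ; injective = AllPairs.map⁻ unique
      }

    module _ {A C : V → Set} (H : Constraints _~_ A C)
             {I J : List X} (enumA : Enumerates A I) (enumC : Enumerates C J) where
      open Constraints H

      hasNonNeighbour-holds : ∀ {i} → i ∈ I → ⟦ hasNonNeighbour J i ⟧
      hasNonNeighbour-holds {i} i∈I = ⟦⟧-stable (hasNonNeighbour J i) λ ¬p →
        has-non-neighbour (∈⇒P enumA i∈I) (adjacent ¬p)
        where
        adjacent : ¬ ⟦ hasNonNeighbour J i ⟧ → ∀ {y} → C y → f i ~ y
        adjacent ¬p Cy with P⇒∈ enumC Cy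
        ... | j , j∈J , refl = decidable-stable (f i ~? f j) λ ¬ij → ¬p (⟦⋁⟧-map⁺ j∈J ¬ij)

      edgeEscapes-holds : ∀ {i s} → i ∈ I → s ∈ selections J → ⟦ edgeEscapes i s ⟧
      edgeEscapes-holds {i} {j , rest} i∈I s = ⟦⟧-stable (edgeEscapes i (j , rest)) λ ¬p →
        edge-escapes (∈⇒P enumA i∈I) (∈⇒P enumC (selection-∈ s))
          (decidable-stable (f i ~? f j) (¬p ∘ inj₁)) (dominated ¬p)
        where
        dominated : ¬ ⟦ edgeEscapes i (j , rest) ⟧ → ∀ {w} → C w → w ≢ f j → w ~ f i ⊎ w ~ f j
        dominated ¬p Cw w≢fj with P⇒∈ enumC Cw
        ... | k , k∈J , refl = decidable-stable ((f k ~? f i) ⊎-dec (f k ~? f j)) λ ¬either →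
          ¬p (inj₂ (⟦⋁⟧-map⁺ (selection-rest f s k∈J w≢fj)
                               (¬either ∘ inj₁ , ¬either ∘ inj₂ , tt)))

      allEdgesEscape-holds : ∀ {i} → i ∈ I → ⟦ allEdgesEscape J i ⟧
      allEdgesEscape-holds i∈I = ⟦⋀⟧-map⁺ (edgeEscapes-holds i∈I)

      on-rest : ∀ {i rest} → (i , rest) ∈ selections I → ∀ {P : V → Set} →
        (∀ {z} → A z → z ≢ f i → P z) → ∀ {z} → z ∈ rest → P (f z)
      on-rest s h z∈rest =
        h (∈⇒P enumA (selection-⊆ s z∈rest)) (selection-distinct f (injective enumA) s z∈rest)

      hasPartner-holds : ∀ {s} → s ∈ selections I → ⟦ hasPartner J s ⟧
      hasPartner-holds {i , rest} s with has-partner (∈⇒P enumA (selection-∈ s))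
      ... | alone Cy ¬iy others with P⇒∈ enumC Cy
      ...   | j , j∈J , refl = ⟦⋁⟧-map⁺ j∈J (¬iy , inj₁ (⟦⋀⟧-map⁺ (on-rest s others)) , tt)
      hasPartner-holds {i , rest} s | via Cy ¬iy Ax′ x′≢fi x′y ¬x′i others
        with P⇒∈ enumC Cy | P⇒∈ enumA Ax′
      ... | j , j∈J , refl | k , k∈I , refl with selection-exists (selection-rest f s k∈I x′≢fi)
      ...   | r′ , s′ =
        ⟦⋁⟧-map⁺ j∈J (¬iy , inj₂ (⟦⋁⟧-map⁺ s′ (x′y , ¬x′i , ⟦⋀⟧-map⁺ dominated , tt)) , tt)
        where
        dominated : ∀ {z} → z ∈ r′ → ⟦ ⋁ (edge z k ∷ edge z j ∷ []) ⟧
        dominated z∈r′ = Data.Sum.map₂ inj₁ (on-rest s others (selection-⊆ s′ z∈r′))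

      sideFormulas-hold : All ⟦_⟧ (sideFormulas I J)
      sideFormulas-hold =
        ++⁺ (map⁺ (All.tabulate hasNonNeighbour-holds))
            (++⁺ (map⁺ (All.tabulate allEdgesEscape-holds)) (map⁺ (All.tabulate hasPartner-holds)))

    configurationFormulas-hold : ∀ {A C} → Constraints _~_ A C → Constraints _~_ C A →
      ∀ {I J} → Enumerates A I → Enumerates C J → All ⟦_⟧ (configurationFormulas I J)
    configurationFormulas-hold HA HC enumA enumC =
      ++⁺ (sideFormulas-hold HA enumA enumC) (sideFormulas-hold HC enumC enumA)

module Refutations where
  open Formulas
  open Encoding
  open import Data.Nat using (ℕ; suc; _+_)
  open import Data.List using (List; upTo; applyUpTo)
  open import Data.Sum using (_⊎_; inj₁; inj₂)
  open import Data.Unit using (tt)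
  open import Relation.Binary.PropositionalEquality using (_≡_; refl)

  -- |A| = p and |C| = q, the vertices being numbered 0, …, p + q - 1.
  indexedConfiguration : ℕ → ℕ → List (Formula ℕ)
  indexedConfiguration p q = configurationFormulas (upTo p) (applyUpTo (p +_) q)

  -- The refutation trees were computed by an external search; Agda checks them by evaluation.
  indexedConfiguration-unsatisfiable₃ : ∀ p q → p + q ≡ 3 → Unsatisfiable (indexedConfiguration p q)
  indexedConfiguration-unsatisfiable₃ 0 _ refl = refutation-unsatisfiable
      (falsify 0)
      tt
  indexedConfiguration-unsatisfiable₃ 1 _ refl = refutation-unsatisfiable
      (branch 0 1 (falsify 3) (falsify 8))
      tt
  indexedConfiguration-unsatisfiable₃ 2 _ refl = refutation-unsatisfiable
      (branch 0 2 (falsify 0) (falsify 5))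
      tt
  indexedConfiguration-unsatisfiable₃ 3 _ refl = refutation-unsatisfiable
      (falsify 0)
      tt
  indexedConfiguration-unsatisfiable₃ (suc (suc (suc (suc (_))))) _ ()

  indexedConfiguration-unsatisfiable₅ : ∀ p q → p + q ≡ 5 → Unsatisfiable (indexedConfiguration p q)
  indexedConfiguration-unsatisfiable₅ 0 _ refl = refutation-unsatisfiable
      (falsify 0)
      tt
  indexedConfiguration-unsatisfiable₅ 1 _ refl = refutation-unsatisfiable
      (branch 0 1 (falsify 3) (branch 0 2 (falsify 4) (branch 0 3 (falsify 5) (falsify 14))))
      tt
  indexedConfiguration-unsatisfiable₅ 2 _ refl = refutation-unsatisfiable
      (branch 0 1 (branch 0 2 (falsify 9) (branch 0 3 (falsify 10) (branch 0 4 (falsify 11) (falsify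
       5)))) (branch 0 2 (branch 1 2 (falsify 6) (branch 0 3 (branch 2 4 (falsify 2) (falsify 13))
       (branch 2 3 (branch 0 4 (falsify 2) (branch 2 4 (falsify 2) (falsify 13))) (falsify 14)))) (branch
       0 3 (branch 1 3 (falsify 7) (branch 2 3 (branch 0 4 (falsify 2) (branch 3 4 (falsify 2) (falsify
       12))) (falsify 14))) (branch 0 4 (branch 1 4 (falsify 5) (branch 2 4 (branch 3 4 (falsify 2)
       (falsify 12)) (falsify 13))) (falsify 5)))))
      tt
  indexedConfiguration-unsatisfiable₅ 3 _ refl = refutation-unsatisfiable
      (branch 0 1 (branch 0 2 (branch 0 3 (falsify 11) (branch 0 4 (falsify 12) (branch 1 2 (falsify 7)
       (branch 1 3 (branch 1 4 (falsify 1) (branch 2 3 (falsify 8) (falsify 6))) (branch 2 4 (falsify 8)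
       (falsify 6)))))) (branch 0 3 (branch 0 4 (falsify 0) (branch 2 3 (falsify 11) (falsify 7)))
       (branch 0 4 (branch 2 4 (falsify 12) (falsify 7)) (falsify 7)))) (branch 0 2 (branch 0 3 (branch 0
       4 (falsify 0) (branch 1 3 (falsify 11) (falsify 8))) (branch 0 4 (branch 1 4 (falsify 12) (falsify
       8)) (falsify 8))) (branch 0 3 (branch 0 4 (falsify 0) (branch 1 3 (falsify 7) (falsify 8)))
       (branch 1 4 (falsify 7) (falsify 8)))))
      tt
  indexedConfiguration-unsatisfiable₅ 4 _ refl = refutation-unsatisfiable
      (branch 0 4 (falsify 0) (branch 1 4 (falsify 1) (branch 2 4 (falsify 2) (falsify 11))))
      tt
  indexedConfiguration-unsatisfiable₅ 5 _ refl = refutation-unsatisfiable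
      (falsify 0)
      tt
  indexedConfiguration-unsatisfiable₅ (suc (suc (suc (suc (suc (suc (_))))))) _ ()

  indexedConfiguration-unsatisfiable₇ : ∀ p q → p + q ≡ 7 → Unsatisfiable (indexedConfiguration p q)
  indexedConfiguration-unsatisfiable₇ 0 _ refl = refutation-unsatisfiable
      (falsify 0)
      tt
  indexedConfiguration-unsatisfiable₇ 1 _ refl = refutation-unsatisfiable
      (branch 0 1 (falsify 3) (branch 0 2 (falsify 4) (branch 0 3 (falsify 5) (branch 0 4 (falsify 6)
       (branch 0 5 (falsify 7) (falsify 20))))))
      tt
  indexedConfiguration-unsatisfiable₇ 2 _ refl = refutation-unsatisfiable
      (branch 0 6 (branch 1 6 (falsify 10) (branch 0 1 (falsify 15) (branch 0 4 (branch 1 4 (falsify 8)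
       (branch 0 3 (branch 1 3 (falsify 7) (branch 0 5 (branch 2 4 (falsify 2) (falsify 19)) (branch 0 2
       (branch 5 6 (falsify 2) (falsify 16)) (branch 1 2 (branch 2 4 (branch 4 5 (falsify 2) (branch 2 3
       (falsify 17) (falsify 20))) (branch 3 5 (falsify 17) (falsify 20))) (branch 4 5 (falsify 18)
       (falsify 17)))))) (branch 1 5 (branch 0 5 (falsify 9) (branch 0 2 (branch 1 2 (falsify 6) (branch
       1 3 (branch 5 6 (branch 3 6 (falsify 2) (branch 2 5 (falsify 16) (falsify 18))) (branch 2 3
       (falsify 16) (falsify 18))) (branch 2 5 (falsify 16) (falsify 18)))) (branch 2 6 (branch 1 3
       (branch 3 6 (branch 5 6 (falsify 2) (branch 3 4 (falsify 17) (falsify 16))) (branch 4 5 (falsify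
       19) (falsify 16))) (branch 3 5 (branch 5 6 (falsify 20) (branch 2 4 (falsify 16) (falsify 17)))
       (falsify 20))) (branch 4 5 (falsify 19) (falsify 17))))) (branch 0 2 (branch 1 2 (falsify 6)
       (branch 3 6 (falsify 20) (falsify 16))) (branch 1 3 (branch 1 2 (branch 2 3 (branch 3 6 (branch 2
       5 (branch 2 4 (branch 2 6 (falsify 3) (branch 3 4 (falsify 18) (falsify 19))) (falsify 20))
       (falsify 20)) (branch 2 4 (falsify 18) (falsify 19))) (branch 4 6 (branch 5 6 (branch 2 4 (branch
       3 6 (branch 2 6 (falsify 2) (branch 3 4 (falsify 18) (falsify 19))) (falsify 18)) (branch 3 5
       (falsify 19) (falsify 20))) (branch 3 6 (branch 2 6 (falsify 20) (branch 3 4 (falsify 18) (falsify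
       19))) (branch 2 4 (falsify 18) (falsify 19)))) (branch 2 5 (branch 3 4 (branch 2 6 (branch 2 4
       (falsify 3) (branch 3 6 (falsify 20) (falsify 19))) (falsify 18)) (branch 2 6 (falsify 16)
       (falsify 19))) (branch 3 4 (falsify 18) (falsify 20))))) (branch 3 6 (falsify 20) (falsify 18)))
       (branch 2 6 (falsify 20) (falsify 18))))))) (branch 1 5 (branch 0 5 (falsify 9) (branch 0 3
       (branch 1 3 (falsify 7) (branch 1 2 (branch 0 2 (falsify 6) (branch 2 5 (branch 4 6 (branch 3 6
       (branch 3 4 (branch 1 4 (falsify 3) (branch 2 4 (branch 4 5 (falsify 18) (branch 2 3 (falsify 17)
       (falsify 20))) (branch 3 5 (falsify 17) (falsify 20)))) (branch 2 6 (falsify 16) (falsify 19)))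
       (branch 3 4 (branch 1 4 (falsify 3) (branch 3 5 (branch 2 3 (falsify 2) (branch 5 6 (falsify 19)
       (falsify 18))) (branch 2 4 (falsify 18) (falsify 20)))) (branch 2 6 (falsify 16) (falsify 19))))
       (branch 3 5 (falsify 19) (falsify 16))) (branch 2 4 (branch 3 6 (branch 1 4 (branch 3 5 (branch 5
       6 (falsify 3) (branch 2 3 (falsify 16) (falsify 18))) (branch 2 6 (falsify 16) (falsify 18)))
       (branch 3 5 (branch 2 6 (branch 2 3 (falsify 3) (branch 5 6 (falsify 19) (falsify 18))) (falsify
       17)) (branch 4 6 (falsify 18) (falsify 16)))) (branch 3 5 (branch 5 6 (falsify 19) (branch 2 3
       (falsify 16) (falsify 18))) (branch 4 6 (falsify 18) (falsify 16)))) (branch 1 4 (branch 3 4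
       (branch 4 6 (falsify 3) (branch 2 3 (falsify 16) (falsify 19))) (branch 2 6 (falsify 16) (falsify
       19))) (branch 3 5 (falsify 17) (falsify 20)))))) (branch 0 2 (branch 3 4 (branch 3 5 (falsify 2)
       (branch 4 6 (falsify 20) (falsify 16))) (branch 5 6 (falsify 20) (falsify 16))) (branch 3 4
       (branch 5 6 (branch 1 4 (branch 4 6 (falsify 18) (branch 3 5 (falsify 17) (falsify 16))) (falsify
       20)) (falsify 17)) (branch 5 6 (falsify 19) (falsify 16)))))) (branch 0 2 (branch 1 2 (falsify 6)
       (branch 3 6 (branch 2 3 (branch 1 3 (falsify 17) (branch 1 4 (branch 2 4 (branch 2 5 (falsify 2)
       (branch 3 4 (falsify 17) (falsify 20))) (branch 5 6 (falsify 19) (falsify 17))) (branch 2 5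
       (falsify 16) (falsify 17)))) (branch 5 6 (falsify 19) (falsify 18))) (branch 2 5 (falsify 19)
       (falsify 18)))) (branch 5 6 (falsify 19) (branch 1 2 (falsify 16) (branch 1 3 (falsify 17)
       (falsify 18))))))) (branch 0 2 (branch 1 2 (falsify 6) (branch 0 3 (branch 1 3 (falsify 7) (branch
       4 6 (falsify 20) (falsify 16))) (branch 1 4 (branch 3 6 (branch 2 4 (branch 4 5 (branch 1 3
       (branch 4 6 (falsify 3) (branch 2 3 (falsify 16) (falsify 19))) (falsify 16)) (falsify 20))
       (falsify 20)) (branch 2 4 (falsify 16) (falsify 19))) (branch 2 3 (falsify 16) (falsify 20)))))
       (branch 1 3 (branch 0 3 (falsify 7) (branch 2 6 (branch 1 2 (branch 2 5 (falsify 16) (branch 3 6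
       (falsify 17) (falsify 18))) (branch 4 6 (branch 3 6 (falsify 20) (branch 4 5 (falsify 18) (falsify
       16))) (branch 3 5 (falsify 17) (falsify 16)))) (branch 3 5 (falsify 17) (falsify 18)))) (branch 1
       2 (branch 3 6 (branch 2 6 (branch 4 6 (falsify 20) (branch 3 4 (branch 4 5 (branch 1 4 (branch 2 3
       (branch 2 5 (falsify 3) (falsify 17)) (falsify 19)) (falsify 20)) (falsify 20)) (falsify 20)))
       (branch 4 5 (branch 3 4 (falsify 18) (falsify 19)) (falsify 17))) (branch 0 3 (branch 2 4 (branch
       0 5 (branch 4 6 (branch 2 6 (falsify 2) (branch 4 5 (falsify 19) (falsify 17))) (branch 2 3
       (falsify 17) (falsify 19))) (branch 1 4 (branch 4 5 (branch 3 4 (branch 4 6 (falsify 3) (branch 2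
       3 (falsify 16) (falsify 19))) (branch 2 6 (falsify 16) (falsify 19))) (branch 2 6 (falsify 20)
       (falsify 17))) (branch 2 3 (falsify 17) (falsify 20)))) (branch 1 4 (branch 0 5 (branch 3 4
       (branch 2 3 (falsify 2) (branch 4 5 (falsify 19) (falsify 20))) (branch 2 6 (falsify 20) (falsify
       19))) (branch 4 5 (branch 2 5 (branch 5 6 (branch 3 4 (branch 2 3 (falsify 17) (falsify 19))
       (falsify 19)) (branch 2 3 (falsify 16) (falsify 18))) (branch 4 6 (falsify 20) (falsify 17)))
       (branch 2 3 (falsify 17) (falsify 20)))) (falsify 17))) (branch 2 5 (falsify 16) (falsify 18))))
       (branch 1 4 (branch 4 6 (falsify 20) (branch 0 3 (falsify 17) (falsify 19))) (falsify 4)))))))))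
       (branch 1 6 (branch 0 1 (falsify 15) (branch 1 4 (branch 0 4 (falsify 8) (branch 1 5 (branch 0 5
       (falsify 9) (branch 1 2 (branch 3 4 (falsify 3) (falsify 16)) (branch 1 3 (branch 2 4 (falsify 3)
       (falsify 17)) (branch 0 3 (branch 2 5 (branch 3 5 (falsify 3) (branch 2 4 (falsify 18) (falsify
       20))) (branch 3 4 (falsify 18) (falsify 20))) (branch 2 6 (falsify 20) (falsify 18)))))) (branch 0
       2 (branch 1 2 (falsify 6) (branch 1 3 (branch 0 3 (falsify 7) (branch 3 5 (branch 2 3 (falsify 3)
       (branch 4 5 (falsify 18) (falsify 20))) (branch 2 6 (falsify 20) (falsify 18)))) (branch 2 4
       (branch 3 6 (branch 5 6 (branch 2 6 (falsify 3) (branch 3 4 (branch 4 5 (falsify 3) (falsify 17))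
       (falsify 19))) (falsify 16)) (falsify 16)) (branch 3 6 (branch 5 6 (falsify 20) (falsify 17))
       (falsify 19))))) (branch 0 3 (branch 1 3 (falsify 7) (branch 2 4 (branch 3 6 (branch 5 6 (falsify
       20) (branch 2 3 (falsify 16) (falsify 18))) (branch 2 5 (falsify 16) (falsify 18))) (branch 5 6
       (branch 2 3 (branch 3 6 (falsify 20) (branch 4 5 (falsify 18) (falsify 16))) (falsify 20)) (branch
       3 4 (falsify 18) (falsify 16))))) (branch 4 5 (falsify 18) (falsify 20)))))) (branch 0 2 (branch 1
       2 (falsify 6) (branch 1 5 (branch 0 5 (falsify 9) (branch 0 3 (branch 1 3 (falsify 7) (branch 2 5
       (branch 3 6 (branch 4 6 (branch 2 6 (falsify 3) (branch 3 5 (falsify 17) (falsify 18))) (falsify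
       16)) (falsify 16)) (branch 3 6 (falsify 17) (falsify 18)))) (branch 5 6 (branch 2 5 (branch 0 4
       (branch 4 6 (branch 3 4 (branch 4 5 (falsify 2) (branch 2 6 (falsify 20) (falsify 17))) (falsify
       19)) (falsify 19)) (falsify 19)) (branch 4 6 (falsify 20) (falsify 17))) (branch 2 5 (branch 4 6
       (branch 2 6 (falsify 20) (branch 4 5 (falsify 19) (falsify 17))) (falsify 19)) (branch 4 6
       (falsify 20) (falsify 17)))))) (branch 0 3 (branch 1 3 (falsify 7) (branch 2 6 (falsify 16)
       (falsify 17))) (branch 0 4 (branch 4 5 (branch 3 5 (branch 2 6 (branch 3 4 (branch 4 6 (falsify 2)
       (branch 2 3 (falsify 16) (falsify 19))) (falsify 16)) (falsify 19)) (branch 4 6 (falsify 18)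
       (falsify 16))) (branch 2 6 (branch 3 5 (branch 0 5 (branch 5 6 (falsify 2) (branch 2 3 (falsify 2)
       (falsify 18))) (falsify 20)) (falsify 16)) (branch 3 4 (falsify 18) (falsify 19)))) (branch 0 5
       (branch 4 5 (branch 2 3 (branch 2 6 (falsify 16) (branch 3 5 (falsify 17) (falsify 18))) (branch 4
       6 (falsify 18) (falsify 19))) (branch 2 6 (falsify 20) (falsify 17))) (branch 2 6 (falsify 20)
       (falsify 17))))))) (branch 0 3 (branch 1 3 (falsify 7) (branch 1 5 (branch 0 5 (falsify 9) (branch
       1 2 (branch 0 4 (branch 2 5 (branch 3 4 (branch 4 5 (branch 3 5 (falsify 3) (branch 2 4 (falsify
       16) (falsify 20))) (branch 3 6 (falsify 20) (falsify 16))) (branch 3 6 (branch 4 6 (falsify 3)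
       (branch 3 5 (falsify 19) (falsify 16))) (branch 2 4 (falsify 16) (falsify 19)))) (branch 3 6
       (branch 4 6 (falsify 3) (branch 2 3 (falsify 16) (falsify 19))) (branch 4 5 (falsify 19) (falsify
       16)))) (branch 2 3 (falsify 16) (falsify 19))) (branch 3 5 (branch 2 6 (branch 2 4 (branch 4 6
       (branch 3 6 (falsify 3) (branch 4 5 (falsify 18) (falsify 16))) (falsify 17)) (falsify 19))
       (falsify 17)) (branch 4 6 (falsify 18) (falsify 16))))) (branch 5 6 (branch 3 6 (branch 2 4
       (branch 1 2 (branch 4 6 (falsify 3) (branch 2 3 (falsify 17) (falsify 19))) (falsify 17)) (falsify
       17)) (branch 2 5 (branch 2 4 (falsify 16) (falsify 19)) (falsify 18))) (branch 2 3 (falsify 17)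
       (falsify 18))))) (branch 1 5 (branch 0 5 (falsify 9) (branch 4 6 (falsify 20) (falsify 19)))
       (branch 0 5 (branch 1 2 (branch 4 5 (branch 2 3 (branch 2 4 (branch 2 5 (falsify 3) (branch 4 6
       (falsify 20) (falsify 17))) (branch 5 6 (falsify 20) (falsify 17))) (branch 2 6 (branch 3 4
       (branch 1 3 (branch 3 5 (falsify 3) (branch 2 4 (falsify 16) (falsify 20))) (branch 4 6 (falsify
       18) (falsify 19))) (branch 5 6 (falsify 20) (falsify 16))) (branch 3 5 (branch 3 4 (branch 1 3
       (falsify 3) (branch 4 6 (falsify 18) (falsify 19))) (branch 2 5 (falsify 16) (falsify 20)))
       (branch 4 6 (falsify 20) (falsify 16))))) (branch 0 4 (branch 2 3 (branch 1 3 (branch 3 4 (branch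
       3 5 (falsify 3) (branch 4 6 (falsify 20) (falsify 16))) (branch 2 5 (falsify 16) (falsify 20)))
       (branch 2 6 (branch 5 6 (branch 4 6 (falsify 20) (branch 3 5 (falsify 17) (falsify 16))) (branch 3
       4 (falsify 17) (falsify 16))) (branch 4 6 (branch 2 5 (branch 2 4 (falsify 3) (branch 5 6 (falsify
       19) (falsify 17))) (falsify 18)) (branch 2 5 (falsify 16) (falsify 17))))) (branch 2 6 (branch 1 3
       (branch 2 4 (branch 2 5 (falsify 3) (branch 3 4 (falsify 17) (falsify 20))) (branch 3 5 (falsify
       17) (falsify 20))) (branch 5 6 (falsify 19) (falsify 18))) (branch 3 6 (branch 2 5 (branch 3 4
       (branch 2 4 (falsify 16) (branch 3 5 (falsify 17) (falsify 20))) (falsify 16)) (branch 4 6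
       (falsify 20) (falsify 17))) (branch 1 3 (branch 2 4 (branch 2 5 (falsify 3) (branch 3 4 (falsify
       17) (falsify 20))) (branch 3 5 (falsify 17) (falsify 20))) (falsify 18))))) (falsify 16))) (branch
       2 5 (branch 3 6 (branch 4 5 (branch 3 4 (branch 3 5 (falsify 17) (branch 4 6 (falsify 18) (falsify
       16))) (branch 2 6 (falsify 16) (falsify 19))) (branch 0 4 (branch 2 6 (branch 3 4 (branch 3 5
       (falsify 17) (branch 4 6 (falsify 18) (falsify 16))) (falsify 16)) (branch 3 5 (falsify 19)
       (falsify 18))) (falsify 17))) (branch 1 3 (branch 3 4 (branch 5 6 (branch 3 5 (falsify 17) (branch
       4 6 (falsify 18) (falsify 16))) (falsify 17)) (branch 5 6 (falsify 19) (falsify 16))) (falsify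
       19))) (branch 4 6 (falsify 20) (falsify 17)))) (branch 4 6 (falsify 20) (branch 1 3 (falsify 17)
       (falsify 16))))))))) (branch 0 2 (branch 1 2 (falsify 6) (branch 0 1 (falsify 11) (branch 0 4
       (branch 1 4 (falsify 8) (branch 0 5 (branch 0 3 (falsify 4) (branch 1 5 (falsify 9) (branch 2 3
       (falsify 16) (falsify 18)))) (branch 1 3 (branch 0 3 (falsify 7) (branch 3 6 (branch 4 6 (branch 2
       5 (branch 3 4 (branch 4 5 (falsify 2) (branch 2 6 (falsify 20) (falsify 17))) (falsify 16))
       (falsify 20)) (branch 2 3 (falsify 17) (falsify 19))) (branch 2 5 (falsify 16) (falsify 18))))
       (branch 2 5 (falsify 16) (falsify 18))))) (branch 1 5 (branch 0 5 (falsify 9) (branch 0 3 (branch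
       1 3 (falsify 7) (branch 2 6 (branch 4 6 (branch 3 5 (branch 2 5 (falsify 19) (branch 3 4 (falsify
       17) (falsify 20))) (falsify 20)) (branch 2 5 (falsify 16) (falsify 17))) (branch 3 5 (falsify 19)
       (falsify 18)))) (branch 2 5 (falsify 19) (branch 1 3 (falsify 17) (falsify 18))))) (branch 0 3
       (branch 1 3 (falsify 7) (branch 3 4 (falsify 17) (falsify 16))) (branch 1 3 (branch 5 6 (branch 3
       6 (branch 2 4 (branch 2 3 (falsify 16) (branch 4 5 (falsify 18) (falsify 20))) (falsify 20))
       (branch 2 4 (falsify 16) (falsify 19))) (branch 2 3 (falsify 17) (falsify 18))) (branch 2 4
       (falsify 16) (falsify 19)))))))) (branch 1 2 (branch 0 1 (falsify 11) (branch 0 5 (branch 1 5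
       (falsify 9) (branch 0 3 (branch 1 3 (falsify 7) (branch 1 4 (branch 0 4 (falsify 8) (branch 2 5
       (branch 4 5 (falsify 19) (branch 2 3 (falsify 16) (falsify 20))) (branch 3 4 (falsify 17) (falsify
       20)))) (branch 2 3 (falsify 17) (falsify 19)))) (branch 1 4 (branch 0 4 (falsify 8) (branch 2 5
       (falsify 16) (falsify 18))) (branch 2 5 (branch 1 3 (branch 3 6 (branch 3 4 (branch 3 5 (falsify
       3) (branch 2 4 (falsify 16) (falsify 20))) (falsify 16)) (falsify 19)) (falsify 19)) (branch 3 4
       (falsify 17) (falsify 20)))))) (branch 0 3 (branch 1 3 (falsify 7) (branch 0 4 (branch 1 4
       (falsify 8) (branch 4 5 (branch 2 3 (branch 4 6 (branch 2 4 (falsify 2) (branch 3 5 (falsify 17)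
       (falsify 20))) (falsify 16)) (falsify 18)) (branch 2 3 (falsify 16) (falsify 20)))) (branch 2 3
       (falsify 16) (branch 1 5 (falsify 19) (falsify 18))))) (branch 1 4 (falsify 5) (branch 2 4
       (falsify 16) (branch 1 3 (falsify 17) (falsify 19))))))) (branch 1 4 (branch 0 4 (falsify 8)
       (branch 0 1 (falsify 13) (branch 1 5 (branch 1 3 (falsify 5) (branch 0 5 (falsify 9) (branch 3 5
       (falsify 19) (falsify 18)))) (branch 4 5 (branch 3 6 (branch 3 5 (falsify 19) (branch 0 5 (branch
       1 3 (branch 0 3 (falsify 7) (falsify 18)) (falsify 19)) (falsify 18))) (falsify 18)) (falsify
       17))))) (branch 0 4 (branch 0 1 (falsify 13) (branch 1 3 (branch 0 3 (falsify 7) (branch 3 4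
       (branch 2 5 (branch 5 6 (branch 1 5 (branch 0 5 (falsify 9) (falsify 17)) (falsify 18)) (falsify
       17)) (falsify 17)) (falsify 19))) (branch 0 5 (falsify 4) (branch 4 5 (falsify 18) (falsify
       17))))) (branch 3 6 (branch 5 6 (falsify 20) (falsify 17)) (falsify 19))))))))
      tt
  indexedConfiguration-unsatisfiable₇ 3 _ refl = refutation-unsatisfiable
      (branch 0 1 (branch 0 2 (branch 0 3 (falsify 13) (branch 0 4 (falsify 14) (branch 0 5 (falsify 15)
       (branch 0 6 (falsify 16) (branch 1 2 (falsify 7) (branch 1 3 (branch 2 3 (falsify 13) (branch 1 4
       (branch 2 4 (falsify 14) (branch 1 5 (branch 3 6 (falsify 4) (falsify 19)) (branch 1 6 (branch 2 6
       (falsify 16) (falsify 6)) (falsify 6)))) (branch 1 5 (branch 2 5 (falsify 15) (branch 1 6 (branch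
       2 6 (falsify 16) (falsify 6)) (falsify 6))) (branch 1 6 (branch 2 6 (falsify 16) (falsify 6))
       (falsify 6))))) (branch 1 4 (branch 2 4 (falsify 14) (branch 1 5 (branch 2 5 (falsify 15) (branch
       1 6 (branch 2 6 (falsify 16) (falsify 6)) (falsify 6))) (branch 1 6 (branch 2 6 (falsify 16)
       (falsify 6)) (falsify 6)))) (branch 1 5 (branch 2 5 (falsify 15) (branch 1 6 (branch 2 6 (falsify
       16) (falsify 6)) (falsify 6))) (branch 2 6 (falsify 8) (falsify 6)))))))))) (branch 0 3 (branch 2
       3 (falsify 13) (branch 0 4 (branch 2 4 (falsify 14) (branch 0 5 (branch 0 6 (falsify 0) (branch 2
       5 (falsify 15) (falsify 7))) (branch 0 6 (branch 2 6 (falsify 16) (falsify 7)) (falsify 7))))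
       (branch 0 5 (branch 2 5 (falsify 15) (branch 0 6 (branch 2 6 (falsify 16) (falsify 7)) (falsify
       7))) (branch 0 6 (branch 2 6 (falsify 16) (falsify 7)) (falsify 7))))) (branch 0 4 (branch 2 4
       (falsify 14) (branch 0 5 (branch 2 5 (falsify 15) (branch 0 6 (branch 2 6 (falsify 16) (falsify
       7)) (falsify 7))) (branch 0 6 (branch 2 6 (falsify 16) (falsify 7)) (falsify 7)))) (branch 0 5
       (branch 2 5 (falsify 15) (branch 0 6 (branch 2 6 (falsify 16) (falsify 7)) (falsify 7))) (branch 0
       6 (branch 2 6 (falsify 16) (falsify 7)) (falsify 7)))))) (branch 0 2 (branch 0 3 (branch 1 3
       (falsify 13) (branch 0 4 (branch 1 4 (falsify 14) (branch 0 5 (branch 0 6 (falsify 0) (branch 1 5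
       (falsify 15) (falsify 8))) (branch 0 6 (branch 1 6 (falsify 16) (falsify 8)) (falsify 8))))
       (branch 0 5 (branch 1 5 (falsify 15) (branch 0 6 (branch 1 6 (falsify 16) (falsify 8)) (falsify
       8))) (branch 0 6 (branch 1 6 (falsify 16) (falsify 8)) (falsify 8))))) (branch 0 4 (branch 1 4
       (falsify 14) (branch 0 5 (branch 1 5 (falsify 15) (branch 0 6 (branch 1 6 (falsify 16) (falsify
       8)) (falsify 8))) (branch 0 6 (branch 1 6 (falsify 16) (falsify 8)) (falsify 8)))) (branch 0 5
       (branch 1 5 (falsify 15) (branch 0 6 (branch 1 6 (falsify 16) (falsify 8)) (falsify 8))) (branch 0
       6 (branch 1 6 (falsify 16) (falsify 8)) (falsify 8))))) (branch 0 3 (branch 0 4 (branch 0 5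
       (branch 0 6 (falsify 0) (branch 3 6 (falsify 3) (branch 4 6 (falsify 3) (branch 5 6 (falsify 3)
       (branch 1 2 (branch 1 3 (falsify 13) (branch 1 4 (falsify 14) (branch 1 5 (falsify 15) (falsify
       8)))) (branch 1 6 (branch 2 6 (branch 1 3 (branch 2 3 (falsify 9) (branch 1 4 (branch 3 5 (falsify
       4) (falsify 18)) (branch 3 4 (branch 1 5 (falsify 4) (branch 3 5 (falsify 4) (falsify 18)))
       (falsify 19)))) (branch 1 4 (branch 2 4 (falsify 10) (branch 3 4 (branch 1 5 (falsify 4) (branch 4
       5 (falsify 4) (falsify 17))) (falsify 19))) (branch 1 5 (branch 2 5 (falsify 8) (branch 3 5
       (branch 4 5 (falsify 4) (falsify 17)) (falsify 18))) (falsify 8)))) (falsify 6)) (falsify 6)))))))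
       (branch 0 6 (branch 3 5 (falsify 3) (branch 4 5 (falsify 3) (branch 5 6 (falsify 3) (branch 1 2
       (branch 1 3 (falsify 13) (branch 1 4 (falsify 14) (branch 1 6 (falsify 16) (falsify 8)))) (branch
       1 5 (branch 2 5 (branch 1 3 (branch 2 3 (falsify 9) (branch 1 4 (branch 3 6 (falsify 4) (falsify
       18)) (branch 3 4 (branch 1 6 (falsify 4) (branch 3 6 (falsify 4) (falsify 18))) (falsify 20))))
       (branch 1 4 (branch 2 4 (falsify 10) (branch 3 4 (branch 1 6 (falsify 4) (branch 4 6 (falsify 4)
       (falsify 17))) (falsify 20))) (branch 1 6 (branch 2 6 (falsify 8) (branch 3 6 (branch 4 6 (falsify
       4) (falsify 17)) (falsify 18))) (falsify 8)))) (falsify 6)) (falsify 6)))))) (branch 1 2 (branch 1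
       3 (falsify 13) (branch 1 4 (falsify 14) (falsify 8))) (branch 1 3 (branch 1 4 (falsify 7) (branch
       2 3 (falsify 8) (branch 2 4 (branch 1 5 (branch 1 6 (branch 3 4 (falsify 4) (branch 4 5 (falsify
       4) (branch 3 5 (branch 3 6 (falsify 3) (branch 4 6 (falsify 4) (falsify 19))) (falsify 20))))
       (branch 2 5 (branch 2 6 (branch 3 4 (falsify 5) (branch 3 5 (falsify 5) (branch 3 6 (falsify 5)
       (branch 4 5 (falsify 18) (falsify 20))))) (branch 3 4 (branch 3 5 (falsify 17) (branch 3 6
       (falsify 4) (branch 4 6 (falsify 5) (falsify 19)))) (branch 3 5 (branch 3 6 (falsify 3) (branch 5
       6 (falsify 5) (falsify 18))) (branch 4 5 (branch 3 6 (branch 4 6 (falsify 3) (branch 5 6 (falsify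
       4) (falsify 17))) (falsify 18)) (falsify 20))))) (falsify 6))) (branch 1 6 (branch 2 6 (branch 2 5
       (branch 3 4 (falsify 5) (branch 3 5 (falsify 5) (branch 3 6 (falsify 5) (branch 4 6 (falsify 18)
       (falsify 19))))) (branch 3 4 (branch 3 5 (falsify 4) (branch 4 5 (falsify 5) (falsify 20)))
       (branch 3 5 (branch 3 6 (falsify 3) (branch 4 6 (branch 4 5 (falsify 3) (branch 5 6 (falsify 4)
       (falsify 17))) (falsify 19))) (branch 4 5 (branch 4 6 (falsify 3) (branch 3 6 (branch 5 6 (falsify
       5) (falsify 18)) (falsify 19))) (falsify 20))))) (falsify 6)) (falsify 6))) (falsify 7)))) (branch
       1 4 (branch 2 3 (branch 2 4 (falsify 8) (branch 1 5 (branch 1 6 (branch 3 4 (falsify 4) (branch 3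
       5 (falsify 4) (branch 3 6 (falsify 4) (branch 4 5 (branch 4 6 (falsify 3) (falsify 19)) (falsify
       20))))) (branch 2 5 (branch 2 6 (branch 3 4 (falsify 5) (branch 4 5 (falsify 5) (branch 3 5
       (branch 4 6 (falsify 5) (falsify 17)) (falsify 20)))) (branch 3 4 (branch 3 5 (falsify 17) (branch
       3 6 (falsify 5) (branch 4 6 (falsify 4) (falsify 19)))) (branch 3 5 (branch 3 6 (falsify 3)
       (branch 5 6 (falsify 4) (falsify 18))) (branch 4 5 (branch 3 6 (branch 4 6 (falsify 3) (branch 5 6
       (falsify 5) (falsify 17))) (falsify 18)) (falsify 20))))) (falsify 6))) (branch 1 6 (branch 2 6
       (branch 2 5 (branch 3 4 (falsify 5) (branch 4 5 (falsify 5) (branch 3 5 (branch 3 6 (falsify 3)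
       (branch 4 6 (falsify 5) (falsify 19))) (falsify 20)))) (branch 3 4 (branch 3 5 (falsify 5) (branch
       4 5 (falsify 4) (falsify 20))) (branch 3 5 (branch 3 6 (falsify 3) (branch 4 6 (branch 4 5
       (falsify 3) (branch 5 6 (falsify 5) (falsify 17))) (falsify 19))) (branch 4 5 (branch 4 6 (falsify
       3) (branch 3 6 (branch 5 6 (falsify 4) (falsify 18)) (falsify 19))) (falsify 20))))) (falsify 6))
       (falsify 6)))) (falsify 7)) (falsify 8)))))) (branch 0 5 (branch 0 6 (branch 3 4 (falsify 3)
       (branch 4 5 (falsify 3) (branch 4 6 (falsify 3) (branch 1 2 (branch 1 3 (falsify 13) (branch 1 5
       (falsify 15) (branch 1 6 (falsify 16) (falsify 8)))) (branch 1 4 (branch 2 4 (branch 1 3 (branch 2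
       3 (falsify 9) (branch 1 5 (branch 3 6 (falsify 4) (falsify 19)) (branch 3 5 (branch 1 6 (falsify
       4) (branch 3 6 (falsify 4) (falsify 19))) (falsify 20)))) (branch 1 5 (branch 2 5 (falsify 11)
       (branch 3 5 (branch 1 6 (falsify 4) (branch 5 6 (falsify 4) (falsify 17))) (falsify 20))) (branch
       1 6 (branch 2 6 (falsify 8) (branch 3 6 (branch 5 6 (falsify 4) (falsify 17)) (falsify 19)))
       (falsify 8)))) (falsify 6)) (falsify 6)))))) (branch 1 2 (branch 1 3 (falsify 13) (branch 1 5
       (falsify 15) (falsify 8))) (branch 1 3 (branch 1 5 (falsify 7) (branch 2 3 (falsify 8) (branch 2 5
       (branch 1 4 (branch 1 6 (branch 3 5 (falsify 4) (branch 4 5 (falsify 4) (branch 3 4 (branch 3 6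
       (falsify 3) (branch 5 6 (falsify 4) (falsify 18))) (falsify 20)))) (branch 2 4 (branch 2 6 (branch
       3 4 (falsify 5) (branch 3 5 (falsify 5) (branch 3 6 (falsify 5) (branch 4 5 (falsify 18) (falsify
       20))))) (branch 3 4 (branch 3 5 (falsify 17) (branch 3 6 (falsify 3) (branch 4 6 (falsify 5)
       (falsify 19)))) (branch 3 5 (branch 3 6 (falsify 4) (branch 5 6 (falsify 5) (falsify 18))) (branch
       4 5 (branch 3 6 (branch 4 6 (falsify 4) (branch 5 6 (falsify 3) (falsify 17))) (falsify 18))
       (falsify 20))))) (falsify 6))) (branch 1 6 (branch 2 6 (branch 2 4 (branch 3 4 (falsify 5) (branch
       3 5 (falsify 5) (branch 3 6 (falsify 5) (branch 5 6 (falsify 19) (falsify 18))))) (branch 3 4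
       (branch 3 5 (falsify 4) (branch 3 6 (falsify 3) (branch 5 6 (branch 4 5 (falsify 3) (branch 4 6
       (falsify 4) (falsify 17))) (falsify 18)))) (branch 4 5 (branch 3 5 (falsify 5) (branch 4 6 (branch
       3 6 (falsify 5) (falsify 18)) (falsify 19))) (falsify 20)))) (falsify 6)) (falsify 6))) (falsify
       7)))) (branch 1 5 (branch 2 3 (branch 2 5 (falsify 8) (branch 1 4 (branch 1 6 (branch 3 4 (falsify
       4) (branch 3 5 (falsify 4) (branch 3 6 (falsify 4) (branch 4 5 (branch 5 6 (falsify 3) (falsify
       18)) (falsify 20))))) (branch 2 4 (branch 2 6 (branch 3 5 (falsify 5) (branch 4 5 (falsify 5)
       (branch 3 4 (branch 5 6 (falsify 5) (falsify 17)) (falsify 20)))) (branch 3 4 (branch 3 5 (falsify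
       17) (branch 3 6 (falsify 3) (branch 4 6 (falsify 4) (falsify 19)))) (branch 3 5 (branch 3 6
       (falsify 5) (branch 5 6 (falsify 4) (falsify 18))) (branch 4 5 (branch 3 6 (branch 4 6 (falsify 5)
       (branch 5 6 (falsify 3) (falsify 17))) (falsify 18)) (falsify 20))))) (falsify 6))) (branch 1 6
       (branch 2 6 (branch 2 4 (branch 3 5 (falsify 5) (branch 4 5 (falsify 5) (branch 3 4 (branch 3 6
       (falsify 3) (branch 5 6 (falsify 5) (falsify 18))) (falsify 20)))) (branch 3 4 (branch 3 5
       (falsify 5) (branch 3 6 (falsify 3) (branch 5 6 (branch 4 5 (falsify 3) (branch 4 6 (falsify 5)
       (falsify 17))) (falsify 18)))) (branch 4 5 (branch 3 5 (falsify 4) (branch 4 6 (branch 3 6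
       (falsify 4) (falsify 18)) (falsify 19))) (falsify 20)))) (falsify 6)) (falsify 6)))) (falsify 7))
       (falsify 8))))) (branch 0 6 (branch 1 2 (branch 1 3 (falsify 13) (branch 1 6 (falsify 16) (falsify
       8))) (branch 1 3 (branch 1 6 (falsify 7) (branch 2 3 (falsify 8) (branch 2 6 (branch 1 4 (branch 1
       5 (branch 3 6 (falsify 4) (branch 4 6 (falsify 4) (branch 3 4 (branch 3 5 (falsify 3) (branch 5 6
       (falsify 4) (falsify 18))) (falsify 19)))) (branch 2 4 (branch 2 5 (branch 3 4 (falsify 5) (branch
       3 5 (falsify 5) (branch 3 6 (falsify 5) (branch 4 6 (falsify 18) (falsify 19))))) (branch 3 4
       (branch 3 5 (falsify 3) (branch 4 5 (falsify 5) (falsify 20))) (branch 3 5 (branch 3 6 (falsify 4)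
       (branch 4 6 (branch 4 5 (falsify 4) (branch 5 6 (falsify 3) (falsify 17))) (falsify 19))) (branch
       4 5 (branch 4 6 (falsify 4) (branch 3 6 (branch 5 6 (falsify 5) (falsify 18)) (falsify 19)))
       (falsify 20))))) (falsify 6))) (branch 1 5 (branch 2 5 (branch 2 4 (branch 3 4 (falsify 5) (branch
       3 5 (falsify 5) (branch 3 6 (falsify 5) (branch 5 6 (falsify 19) (falsify 18))))) (branch 3 4
       (branch 3 5 (falsify 3) (branch 3 6 (falsify 4) (branch 5 6 (branch 4 5 (falsify 4) (branch 4 6
       (falsify 3) (falsify 17))) (falsify 18)))) (branch 4 5 (branch 3 5 (falsify 5) (branch 4 6 (branch
       3 6 (falsify 5) (falsify 18)) (falsify 19))) (falsify 20)))) (falsify 6)) (falsify 6))) (falsify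
       7)))) (branch 1 6 (branch 2 3 (branch 2 6 (falsify 8) (branch 1 4 (branch 1 5 (branch 3 4 (falsify
       4) (branch 3 5 (falsify 4) (branch 3 6 (falsify 4) (branch 4 6 (branch 5 6 (falsify 3) (falsify
       18)) (falsify 19))))) (branch 2 4 (branch 2 5 (branch 3 6 (falsify 5) (branch 4 6 (falsify 5)
       (branch 3 4 (branch 5 6 (falsify 5) (falsify 17)) (falsify 19)))) (branch 3 4 (branch 3 5 (falsify
       3) (branch 4 5 (falsify 4) (falsify 20))) (branch 3 5 (branch 3 6 (falsify 5) (branch 4 6 (branch
       4 5 (falsify 5) (branch 5 6 (falsify 3) (falsify 17))) (falsify 19))) (branch 4 5 (branch 4 6
       (falsify 5) (branch 3 6 (branch 5 6 (falsify 4) (falsify 18)) (falsify 19))) (falsify 20)))))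
       (falsify 6))) (branch 1 5 (branch 2 5 (branch 2 4 (branch 3 6 (falsify 5) (branch 4 6 (falsify 5)
       (branch 3 4 (branch 3 5 (falsify 3) (branch 5 6 (falsify 5) (falsify 18))) (falsify 19)))) (branch
       3 4 (branch 3 5 (falsify 3) (branch 3 6 (falsify 5) (branch 5 6 (branch 4 5 (falsify 5) (branch 4
       6 (falsify 3) (falsify 17))) (falsify 18)))) (branch 4 5 (branch 3 5 (falsify 4) (branch 4 6
       (branch 3 6 (falsify 4) (falsify 18)) (falsify 19))) (falsify 20)))) (falsify 6)) (falsify 6))))
       (falsify 7)) (falsify 8)))) (branch 1 3 (falsify 7) (falsify 8))))) (branch 0 4 (branch 0 5
       (branch 0 6 (branch 3 4 (falsify 3) (branch 3 5 (falsify 3) (branch 3 6 (falsify 3) (branch 1 2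
       (branch 1 4 (falsify 14) (branch 1 5 (falsify 15) (branch 1 6 (falsify 16) (falsify 8)))) (branch
       1 3 (branch 2 3 (branch 1 4 (branch 2 4 (falsify 10) (branch 1 5 (branch 4 6 (falsify 4) (falsify
       19)) (branch 4 5 (branch 1 6 (falsify 4) (branch 4 6 (falsify 4) (falsify 19))) (falsify 20))))
       (branch 1 5 (branch 2 5 (falsify 11) (branch 4 5 (branch 1 6 (falsify 4) (branch 5 6 (falsify 4)
       (falsify 18))) (falsify 20))) (branch 1 6 (branch 2 6 (falsify 8) (branch 4 6 (branch 5 6 (falsify
       4) (falsify 18)) (falsify 19))) (falsify 8)))) (falsify 6)) (falsify 6)))))) (branch 1 2 (branch 1
       4 (falsify 14) (branch 1 5 (falsify 15) (falsify 8))) (branch 1 3 (branch 1 4 (branch 1 5 (falsify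
       7) (branch 2 4 (falsify 8) (branch 2 5 (branch 1 6 (branch 3 5 (falsify 4) (branch 4 5 (falsify 4)
       (branch 3 4 (branch 4 6 (falsify 3) (branch 5 6 (falsify 4) (falsify 17))) (falsify 20)))) (branch
       2 3 (branch 2 6 (branch 3 4 (falsify 5) (branch 4 5 (falsify 5) (branch 3 5 (branch 4 6 (falsify
       5) (falsify 17)) (falsify 20)))) (branch 3 4 (branch 3 5 (falsify 17) (branch 3 6 (falsify 5)
       (branch 4 6 (falsify 3) (falsify 19)))) (branch 3 5 (branch 3 6 (falsify 4) (branch 5 6 (falsify
       3) (falsify 18))) (branch 4 5 (branch 3 6 (branch 4 6 (falsify 4) (branch 5 6 (falsify 5) (falsify
       17))) (falsify 18)) (falsify 20))))) (falsify 6))) (falsify 7)))) (branch 1 5 (branch 2 4 (branch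
       2 5 (falsify 8) (branch 1 6 (branch 3 4 (falsify 4) (branch 4 5 (falsify 4) (branch 3 5 (branch 4
       6 (falsify 4) (branch 5 6 (falsify 3) (falsify 17))) (falsify 20)))) (branch 2 3 (branch 2 6
       (branch 3 5 (falsify 5) (branch 4 5 (falsify 5) (branch 3 4 (branch 5 6 (falsify 5) (falsify 17))
       (falsify 20)))) (branch 3 4 (branch 3 5 (falsify 17) (branch 3 6 (falsify 4) (branch 4 6 (falsify
       3) (falsify 19)))) (branch 3 5 (branch 3 6 (falsify 5) (branch 5 6 (falsify 3) (falsify 18)))
       (branch 4 5 (branch 3 6 (branch 4 6 (falsify 5) (branch 5 6 (falsify 4) (falsify 17))) (falsify
       18)) (falsify 20))))) (falsify 6)))) (falsify 7)) (falsify 8))) (branch 1 6 (branch 2 6 (branch 1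
       4 (branch 1 5 (falsify 7) (branch 2 4 (falsify 8) (branch 2 5 (branch 2 3 (branch 3 4 (falsify 5)
       (branch 3 5 (branch 3 6 (branch 4 5 (falsify 5) (branch 4 6 (falsify 5) (falsify 17))) (falsify
       19)) (falsify 20))) (branch 3 4 (branch 4 5 (falsify 4) (branch 4 6 (falsify 3) (branch 5 6
       (branch 3 5 (falsify 3) (branch 3 6 (falsify 4) (falsify 18))) (falsify 17)))) (branch 3 5 (branch
       3 6 (branch 4 5 (falsify 5) (branch 4 6 (falsify 5) (falsify 17))) (falsify 19)) (falsify 20))))
       (falsify 7)))) (branch 1 5 (branch 2 4 (branch 2 5 (falsify 8) (branch 2 3 (branch 3 5 (falsify 5)
       (branch 3 4 (branch 3 6 (branch 4 5 (falsify 5) (branch 5 6 (falsify 5) (falsify 17))) (falsify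
       18)) (falsify 20))) (branch 3 4 (branch 4 5 (falsify 5) (branch 4 6 (falsify 3) (branch 5 6
       (branch 3 5 (falsify 3) (branch 3 6 (falsify 5) (falsify 18))) (falsify 17)))) (branch 3 5 (branch
       3 6 (branch 4 5 (falsify 4) (branch 4 6 (falsify 4) (falsify 17))) (falsify 19)) (falsify 20)))))
       (falsify 7)) (falsify 8))) (falsify 6)) (falsify 6))))) (branch 0 6 (branch 1 2 (branch 1 4
       (falsify 14) (branch 1 6 (falsify 16) (falsify 8))) (branch 1 3 (branch 1 4 (branch 1 6 (falsify
       7) (branch 2 4 (falsify 8) (branch 2 6 (branch 1 5 (branch 3 6 (falsify 4) (branch 4 6 (falsify 4)
       (branch 3 4 (branch 4 5 (falsify 3) (branch 5 6 (falsify 4) (falsify 17))) (falsify 19)))) (branch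
       2 3 (branch 2 5 (branch 3 4 (falsify 5) (branch 4 5 (falsify 5) (branch 3 5 (branch 3 6 (falsify
       4) (branch 4 6 (falsify 5) (falsify 19))) (falsify 20)))) (branch 3 4 (branch 3 5 (falsify 5)
       (branch 4 5 (falsify 3) (falsify 20))) (branch 3 5 (branch 3 6 (falsify 4) (branch 4 6 (branch 4 5
       (falsify 4) (branch 5 6 (falsify 5) (falsify 17))) (falsify 19))) (branch 4 5 (branch 4 6 (falsify
       4) (branch 3 6 (branch 5 6 (falsify 3) (falsify 18)) (falsify 19))) (falsify 20))))) (falsify 6)))
       (falsify 7)))) (branch 1 6 (branch 2 4 (branch 2 6 (falsify 8) (branch 1 5 (branch 3 4 (falsify 4)
       (branch 4 5 (falsify 4) (branch 4 6 (falsify 4) (branch 3 6 (branch 5 6 (falsify 3) (falsify 17))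
       (falsify 19))))) (branch 2 3 (branch 2 5 (branch 3 6 (falsify 5) (branch 4 6 (falsify 5) (branch 3
       4 (branch 5 6 (falsify 5) (falsify 17)) (falsify 19)))) (branch 3 4 (branch 3 5 (falsify 4)
       (branch 4 5 (falsify 3) (falsify 20))) (branch 3 5 (branch 3 6 (falsify 5) (branch 4 6 (branch 4 5
       (falsify 5) (branch 5 6 (falsify 4) (falsify 17))) (falsify 19))) (branch 4 5 (branch 4 6 (falsify
       5) (branch 3 6 (branch 5 6 (falsify 3) (falsify 18)) (falsify 19))) (falsify 20))))) (falsify
       6)))) (falsify 7)) (falsify 8))) (branch 1 5 (branch 2 5 (branch 1 4 (branch 1 6 (falsify 7)
       (branch 2 4 (falsify 8) (branch 2 6 (branch 2 3 (branch 3 4 (falsify 5) (branch 3 5 (branch 3 6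
       (branch 4 5 (falsify 5) (branch 4 6 (falsify 5) (falsify 17))) (falsify 19)) (falsify 20)))
       (branch 3 4 (branch 4 5 (falsify 3) (branch 4 6 (falsify 4) (branch 5 6 (branch 3 5 (falsify 4)
       (branch 3 6 (falsify 3) (falsify 18))) (falsify 17)))) (branch 3 5 (branch 3 6 (branch 4 5
       (falsify 5) (branch 4 6 (falsify 5) (falsify 17))) (falsify 19)) (falsify 20)))) (falsify 7))))
       (branch 1 6 (branch 2 4 (branch 2 6 (falsify 8) (branch 2 3 (branch 3 6 (falsify 5) (branch 3 4
       (branch 3 5 (branch 4 5 (falsify 3) (branch 4 6 (falsify 5) (branch 5 6 (falsify 5) (falsify
       17)))) (falsify 18)) (falsify 19))) (branch 3 4 (branch 4 5 (falsify 3) (branch 4 6 (falsify 5)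
       (branch 5 6 (branch 3 5 (falsify 5) (branch 3 6 (falsify 3) (falsify 18))) (falsify 17)))) (branch
       3 5 (branch 3 6 (branch 4 5 (falsify 4) (branch 4 6 (falsify 4) (falsify 17))) (falsify 19))
       (falsify 20))))) (falsify 7)) (falsify 8))) (falsify 6)) (falsify 6)))) (branch 1 4 (falsify 7)
       (falsify 8)))) (branch 0 5 (branch 0 6 (branch 1 2 (branch 1 5 (falsify 15) (branch 1 6 (falsify
       16) (falsify 8))) (branch 1 3 (branch 1 4 (branch 1 5 (branch 1 6 (falsify 1) (branch 2 5 (falsify
       8) (branch 2 6 (branch 3 6 (falsify 4) (branch 4 6 (falsify 4) (branch 5 6 (falsify 4) (branch 3 5
       (branch 4 5 (falsify 3) (falsify 17)) (falsify 18))))) (falsify 7)))) (branch 1 6 (branch 2 5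
       (branch 2 6 (falsify 8) (branch 3 5 (falsify 4) (branch 4 5 (falsify 4) (branch 5 6 (falsify 4)
       (branch 3 6 (branch 4 6 (falsify 3) (falsify 17)) (falsify 18)))))) (falsify 7)) (falsify 8)))
       (branch 2 3 (branch 1 5 (branch 1 6 (falsify 7) (branch 2 5 (falsify 8) (branch 2 6 (branch 2 4
       (branch 3 5 (falsify 5) (branch 4 5 (falsify 5) (branch 3 4 (branch 3 6 (falsify 4) (branch 5 6
       (falsify 5) (falsify 18))) (falsify 20)))) (branch 3 4 (branch 3 5 (falsify 5) (branch 3 6
       (falsify 4) (branch 5 6 (branch 4 5 (falsify 4) (branch 4 6 (falsify 5) (falsify 17))) (falsify
       18)))) (branch 4 5 (branch 3 5 (falsify 3) (branch 4 6 (branch 3 6 (falsify 3) (falsify 18))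
       (falsify 19))) (falsify 20)))) (falsify 7)))) (branch 1 6 (branch 2 5 (branch 2 6 (falsify 8)
       (branch 2 4 (branch 3 6 (falsify 5) (branch 4 6 (falsify 5) (branch 3 4 (branch 3 5 (falsify 4)
       (branch 5 6 (falsify 5) (falsify 18))) (falsify 19)))) (branch 3 4 (branch 3 5 (falsify 4) (branch
       3 6 (falsify 5) (branch 5 6 (branch 4 5 (falsify 5) (branch 4 6 (falsify 4) (falsify 17)))
       (falsify 18)))) (branch 4 5 (branch 3 5 (falsify 3) (branch 4 6 (branch 3 6 (falsify 3) (falsify
       18)) (falsify 19))) (falsify 20))))) (falsify 7)) (falsify 8))) (falsify 6))) (branch 1 4 (branch
       2 4 (branch 1 5 (branch 1 6 (falsify 7) (branch 2 5 (falsify 8) (branch 2 6 (branch 2 3 (branch 3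
       5 (falsify 5) (branch 3 4 (branch 3 6 (branch 4 5 (falsify 5) (branch 5 6 (falsify 5) (falsify
       17))) (falsify 18)) (falsify 20))) (branch 3 4 (branch 4 5 (falsify 5) (branch 4 6 (falsify 4)
       (branch 5 6 (branch 3 5 (falsify 4) (branch 3 6 (falsify 5) (falsify 18))) (falsify 17)))) (branch
       3 5 (branch 3 6 (branch 4 5 (falsify 3) (branch 4 6 (falsify 3) (falsify 17))) (falsify 19))
       (falsify 20)))) (falsify 7)))) (branch 1 6 (branch 2 5 (branch 2 6 (falsify 8) (branch 2 3 (branch
       3 6 (falsify 5) (branch 3 4 (branch 3 5 (branch 4 5 (falsify 3) (branch 4 6 (falsify 5) (branch 5
       6 (falsify 5) (falsify 17)))) (falsify 18)) (falsify 19))) (branch 3 4 (branch 4 5 (falsify 4)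
       (branch 4 6 (falsify 5) (branch 5 6 (branch 3 5 (falsify 5) (branch 3 6 (falsify 4) (falsify 18)))
       (falsify 17)))) (branch 3 5 (branch 3 6 (branch 4 5 (falsify 3) (branch 4 6 (falsify 3) (falsify
       17))) (falsify 19)) (falsify 20))))) (falsify 7)) (falsify 8))) (falsify 6)) (falsify 6))))
       (branch 1 5 (falsify 7) (falsify 8))) (branch 1 6 (falsify 7) (falsify 8)))))))
      tt
  indexedConfiguration-unsatisfiable₇ 4 _ refl = refutation-unsatisfiable
      (branch 1 6 (branch 2 6 (branch 0 5 (branch 1 4 (branch 1 5 (falsify 1) (branch 5 6 (falsify 5)
       (branch 4 5 (falsify 5) (branch 3 6 (branch 0 6 (falsify 14) (branch 0 4 (branch 4 6 (falsify 4)
       (branch 0 3 (falsify 17) (branch 0 1 (falsify 17) (branch 0 2 (falsify 17) (branch 3 4 (branch 1 2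
       (falsify 15) (falsify 11)) (branch 1 3 (branch 2 4 (falsify 15) (branch 1 2 (falsify 15) (falsify
       11))) (falsify 10))))))) (falsify 20))) (branch 0 4 (branch 2 4 (falsify 18) (branch 0 6 (falsify
       0) (branch 4 6 (falsify 4) (branch 2 5 (branch 3 5 (branch 1 3 (falsify 16) (branch 0 2 (falsify
       8) (branch 2 3 (branch 3 4 (falsify 15) (branch 0 3 (branch 1 2 (falsify 16) (branch 0 1 (falsify
       16) (falsify 11))) (falsify 10))) (falsify 8)))) (branch 3 4 (branch 1 2 (falsify 15) (branch 2 3
       (falsify 15) (branch 0 1 (falsify 8) (branch 0 2 (falsify 15) (falsify 11))))) (branch 0 3 (branch
       0 1 (falsify 16) (branch 0 2 (falsify 15) (branch 1 2 (branch 1 3 (falsify 15) (branch 2 3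
       (falsify 16) (falsify 8))) (falsify 11)))) (branch 1 2 (falsify 9) (branch 1 3 (branch 2 3 (branch
       0 1 (falsify 17) (branch 0 2 (falsify 17) (falsify 11))) (falsify 9)) (falsify 10)))))) (falsify
       18))))) (branch 3 4 (branch 3 5 (branch 4 6 (falsify 7) (branch 2 4 (branch 0 6 (branch 2 5
       (falsify 2) (branch 0 3 (falsify 15) (branch 2 3 (falsify 17) (branch 0 2 (falsify 15) (falsify
       9))))) (falsify 18)) (branch 2 5 (branch 1 2 (falsify 16) (branch 0 1 (falsify 16) (branch 2 3
       (falsify 10) (branch 1 3 (falsify 16) (falsify 8))))) (branch 0 6 (branch 1 3 (falsify 17) (branch
       0 3 (falsify 17) (branch 2 3 (falsify 17) (branch 0 1 (falsify 8) (falsify 10))))) (falsify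
       18))))) (falsify 20)) (falsify 20))))))) (branch 2 5 (branch 2 4 (falsify 2) (branch 4 6 (falsify
       6) (branch 3 5 (falsify 19) (branch 4 5 (falsify 6) (branch 0 6 (falsify 20) (branch 3 6 (branch 0
       4 (branch 5 6 (falsify 4) (branch 3 4 (branch 0 1 (falsify 17) (branch 2 3 (falsify 10) (branch 1
       3 (branch 1 5 (falsify 16) (branch 1 2 (branch 0 2 (falsify 17) (branch 0 3 (falsify 17) (falsify
       9))) (falsify 11))) (falsify 10)))) (falsify 19))) (falsify 20)) (falsify 19))))))) (branch 0 6
       (branch 3 6 (falsify 14) (branch 0 4 (falsify 0) (branch 1 3 (falsify 17) (branch 0 2 (falsify 8)
       (branch 2 4 (branch 4 5 (falsify 4) (branch 4 6 (falsify 4) (branch 5 6 (falsify 6) (branch 3 5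
       (branch 3 4 (branch 1 2 (branch 1 5 (falsify 16) (branch 0 1 (branch 0 3 (falsify 17) (branch 2 3
       (falsify 17) (falsify 9))) (falsify 10))) (falsify 8)) (falsify 20)) (falsify 20))))) (falsify
       8)))))) (branch 3 6 (branch 0 3 (falsify 17) (branch 0 1 (falsify 17) (branch 0 2 (falsify 17)
       (branch 1 2 (branch 0 4 (branch 4 6 (falsify 4) (branch 5 6 (falsify 4) (branch 4 5 (branch 2 4
       (falsify 6) (branch 1 5 (falsify 5) (falsify 11))) (branch 3 4 (branch 3 5 (falsify 3) (branch 1 3
       (falsify 11) (falsify 10))) (branch 3 5 (branch 2 3 (falsify 11) (falsify 9)) (falsify 9))))))
       (branch 3 5 (falsify 11) (falsify 9))) (falsify 11))))) (branch 1 5 (branch 4 5 (falsify 5)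
       (branch 4 6 (falsify 5) (branch 2 4 (branch 5 6 (falsify 6) (branch 3 5 (branch 2 3 (falsify 16)
       (branch 1 2 (falsify 16) (branch 0 2 (falsify 16) (branch 0 1 (branch 1 3 (falsify 17) (falsify
       8)) (falsify 11))))) (branch 0 4 (branch 3 4 (branch 1 3 (falsify 15) (branch 0 2 (falsify 8)
       (branch 2 3 (branch 0 3 (branch 1 2 (falsify 15) (branch 0 1 (falsify 15) (falsify 11))) (falsify
       10)) (falsify 8)))) (branch 2 3 (branch 0 2 (falsify 17) (branch 1 2 (falsify 15) (branch 0 1
       (branch 1 3 (falsify 17) (branch 0 3 (falsify 15) (falsify 10))) (falsify 11)))) (branch 0 1
       (falsify 8) (branch 1 3 (branch 1 2 (falsify 16) (branch 0 3 (branch 0 2 (falsify 16) (falsify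
       11)) (falsify 9))) (falsify 8))))) (falsify 20)))) (falsify 19)))) (branch 5 6 (branch 4 6
       (falsify 5) (branch 2 4 (falsify 6) (falsify 19))) (falsify 18))))))) (branch 3 6 (branch 0 6
       (falsify 14) (branch 4 6 (falsify 20) (branch 0 2 (falsify 17) (branch 0 3 (falsify 17) (branch 0
       1 (falsify 17) (branch 3 4 (falsify 11) (branch 2 4 (falsify 10) (falsify 9)))))))) (branch 2 4
       (branch 2 5 (falsify 2) (branch 4 5 (falsify 6) (branch 5 6 (falsify 6) (branch 1 4 (falsify 18)
       (branch 1 5 (branch 4 6 (falsify 5) (branch 3 4 (branch 3 5 (branch 0 6 (branch 1 3 (falsify 17)
       (branch 2 3 (falsify 17) (branch 0 3 (falsify 17) (branch 1 2 (falsify 10) (falsify 8))))) (branch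
       0 4 (branch 1 3 (falsify 15) (branch 1 2 (falsify 15) (branch 0 1 (falsify 15) (branch 2 3
       (falsify 10) (falsify 8))))) (branch 2 3 (branch 0 2 (falsify 17) (branch 0 3 (falsify 16)
       (falsify 9))) (branch 0 1 (branch 1 3 (falsify 17) (branch 1 2 (falsify 16) (falsify 8))) (branch
       0 2 (branch 0 3 (branch 1 3 (falsify 15) (branch 1 2 (falsify 15) (falsify 8))) (falsify 10))
       (falsify 11)))))) (falsify 20)) (falsify 20))) (falsify 18)))))) (branch 0 6 (branch 0 3 (falsify
       17) (branch 2 3 (falsify 17) (branch 1 3 (falsify 17) (branch 0 2 (branch 1 5 (branch 1 4 (falsify
       1) (branch 0 1 (falsify 9) (falsify 10))) (branch 1 4 (branch 1 2 (falsify 9) (falsify 8))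
       (falsify 8))) (falsify 9))))) (branch 0 4 (branch 1 5 (branch 4 6 (falsify 5) (falsify 19))
       (branch 4 6 (branch 4 5 (falsify 4) (branch 5 6 (falsify 5) (branch 2 5 (falsify 6) (falsify
       18)))) (branch 1 4 (branch 4 5 (falsify 5) (branch 5 6 (falsify 5) (branch 3 4 (branch 2 5 (branch
       3 5 (branch 1 2 (falsify 15) (branch 0 2 (falsify 15) (branch 1 3 (falsify 9) (branch 2 3 (falsify
       15) (falsify 8))))) (falsify 20)) (falsify 18)) (falsify 20)))) (falsify 19)))) (branch 1 4
       (branch 1 5 (falsify 1) (branch 4 5 (falsify 5) (branch 5 6 (falsify 5) (branch 2 5 (branch 4 6
       (falsify 6) (branch 3 4 (branch 3 5 (branch 2 3 (branch 0 3 (falsify 15) (branch 0 2 (falsify 17)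
       (falsify 9))) (branch 0 1 (branch 1 3 (falsify 17) (branch 1 2 (falsify 15) (falsify 8))) (branch
       0 3 (branch 1 3 (falsify 16) (branch 0 2 (branch 1 2 (falsify 16) (falsify 8)) (falsify 11)))
       (falsify 10)))) (falsify 20)) (falsify 20))) (falsify 18))))) (branch 4 6 (branch 1 5 (falsify 5)
       (branch 5 6 (falsify 5) (branch 2 5 (falsify 6) (falsify 18)))) (falsify 19)))))))) (branch 3 5
       (branch 1 4 (branch 1 5 (falsify 1) (branch 5 6 (falsify 5) (branch 4 5 (falsify 5) (branch 0 4
       (branch 3 4 (falsify 18) (branch 3 6 (branch 4 6 (falsify 7) (branch 0 6 (branch 0 5 (falsify 0)
       (branch 2 4 (branch 2 5 (branch 1 2 (falsify 17) (branch 1 3 (falsify 15) (falsify 8))) (falsify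
       20)) (falsify 20))) (branch 2 4 (branch 1 3 (falsify 15) (branch 2 3 (falsify 15) (branch 0 3
       (falsify 15) (branch 0 1 (branch 1 2 (falsify 17) (falsify 8)) (falsify 10))))) (branch 0 5
       (branch 2 5 (branch 1 3 (falsify 16) (branch 1 2 (falsify 16) (branch 0 3 (falsify 8) (branch 0 1
       (falsify 16) (falsify 10))))) (branch 1 2 (branch 1 3 (falsify 15) (branch 0 1 (falsify 17)
       (branch 0 3 (branch 0 2 (falsify 15) (branch 2 3 (falsify 17) (falsify 9))) (falsify 10))))
       (branch 0 3 (falsify 8) (branch 2 3 (branch 0 2 (branch 1 3 (falsify 16) (branch 0 1 (falsify 16)
       (falsify 10))) (falsify 11)) (falsify 8))))) (falsify 20))))) (falsify 18))) (branch 4 6 (branch 3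
       4 (falsify 7) (branch 3 6 (falsify 7) (branch 2 4 (branch 2 5 (falsify 6) (falsify 20)) (falsify
       20)))) (branch 3 6 (branch 3 4 (falsify 3) (branch 2 5 (branch 2 4 (branch 0 5 (branch 0 1
       (falsify 16) (branch 2 3 (falsify 11) (branch 0 2 (branch 0 6 (falsify 17) (branch 0 3 (branch 1 3
       (falsify 16) (branch 1 2 (falsify 16) (falsify 8))) (falsify 10))) (falsify 11)))) (branch 0 6
       (branch 0 2 (falsify 17) (branch 1 3 (falsify 9) (branch 0 1 (branch 0 3 (branch 1 2 (falsify 17)
       (branch 2 3 (falsify 17) (falsify 8))) (falsify 9)) (falsify 11)))) (branch 2 3 (branch 0 3
       (falsify 17) (branch 0 2 (falsify 15) (falsify 9))) (branch 0 1 (branch 1 2 (falsify 17) (branch 1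
       3 (falsify 15) (falsify 8))) (branch 0 3 (branch 0 2 (branch 1 2 (falsify 16) (branch 1 3 (falsify
       16) (falsify 8))) (falsify 11)) (falsify 10)))))) (falsify 20)) (falsify 20))) (branch 0 5 (branch
       0 6 (branch 2 5 (branch 0 1 (falsify 16) (branch 1 3 (falsify 16) (branch 1 2 (falsify 16) (branch
       0 2 (branch 0 3 (falsify 17) (falsify 10)) (falsify 11))))) (branch 3 4 (branch 2 4 (branch 0 3
       (falsify 15) (branch 0 1 (falsify 15) (branch 0 2 (falsify 15) (branch 1 3 (falsify 9) (falsify
       10))))) (branch 0 2 (branch 0 1 (falsify 16) (branch 0 3 (falsify 17) (branch 1 3 (branch 2 3
       (falsify 16) (branch 1 2 (falsify 17) (falsify 8))) (falsify 10)))) (branch 1 3 (falsify 9)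
       (branch 2 3 (branch 0 3 (falsify 15) (branch 1 2 (branch 0 1 (falsify 15) (falsify 10)) (falsify
       11))) (falsify 9))))) (falsify 20))) (falsify 18)) (falsify 18)))))))) (branch 1 5 (branch 4 5
       (falsify 5) (branch 4 6 (falsify 5) (branch 0 5 (falsify 19) (branch 0 4 (branch 0 6 (branch 5 6
       (falsify 4) (branch 3 6 (branch 3 4 (falsify 3) (branch 2 5 (branch 2 4 (branch 1 2 (falsify 17)
       (branch 0 1 (falsify 16) (falsify 11))) (falsify 20)) (falsify 20))) (branch 2 5 (branch 0 3
       (falsify 16) (branch 0 2 (falsify 16) (branch 0 1 (falsify 16) (branch 1 2 (branch 1 3 (falsify
       17) (falsify 10)) (falsify 11))))) (branch 3 4 (branch 2 4 (branch 0 1 (falsify 15) (branch 1 2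
       (falsify 15) (branch 0 3 (falsify 8) (branch 1 3 (falsify 15) (falsify 10))))) (branch 0 1 (branch
       0 2 (falsify 15) (branch 1 2 (falsify 16) (falsify 11))) (branch 2 3 (branch 0 3 (falsify 16)
       (branch 1 3 (falsify 15) (falsify 10))) (branch 1 2 (branch 0 2 (branch 0 3 (falsify 17) (branch 1
       3 (falsify 17) (falsify 10))) (falsify 9)) (falsify 8))))) (falsify 20))))) (falsify 19)) (falsify
       19))))) (branch 0 6 (branch 3 6 (branch 3 4 (falsify 3) (branch 4 6 (falsify 7) (branch 0 5
       (falsify 19) (branch 0 4 (branch 4 5 (falsify 4) (branch 5 6 (falsify 4) (branch 2 4 (branch 2 5
       (branch 0 2 (falsify 17) (branch 2 3 (falsify 17) (branch 1 2 (falsify 17) (branch 0 3 (falsify 8)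
       (falsify 9))))) (falsify 20)) (falsify 20)))) (falsify 19))))) (branch 5 6 (branch 4 6 (falsify 4)
       (branch 0 4 (falsify 4) (falsify 19))) (branch 0 4 (falsify 18) (branch 0 5 (branch 4 6 (falsify
       4) (falsify 19)) (falsify 18))))) (branch 4 6 (branch 5 6 (falsify 5) (branch 3 6 (falsify 7)
       (falsify 18))) (falsify 19))))) (branch 0 4 (branch 1 4 (branch 5 6 (falsify 5) (falsify 18))
       (branch 0 6 (branch 0 5 (falsify 0) (branch 4 5 (falsify 4) (branch 5 6 (falsify 4) (branch 1 5
       (branch 4 6 (falsify 5) (branch 2 5 (branch 2 4 (branch 3 6 (branch 1 2 (falsify 17) (branch 0 2
       (falsify 17) (branch 2 3 (falsify 17) (branch 0 1 (falsify 8) (falsify 11))))) (branch 3 4 (branch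
       1 2 (falsify 15) (branch 0 1 (falsify 15) (branch 1 3 (falsify 15) (branch 0 2 (falsify 8)
       (falsify 11))))) (branch 1 2 (branch 1 3 (falsify 17) (branch 2 3 (falsify 15) (falsify 8)))
       (branch 0 3 (branch 0 2 (falsify 17) (branch 0 1 (falsify 15) (falsify 11))) (branch 1 3 (branch 2
       3 (branch 0 2 (falsify 16) (branch 0 1 (falsify 16) (falsify 11))) (falsify 9)) (falsify 10))))))
       (falsify 20)) (falsify 20))) (falsify 18))))) (branch 1 5 (branch 4 6 (falsify 5) (branch 4 5
       (falsify 5) (branch 3 4 (branch 3 6 (branch 5 6 (falsify 7) (branch 2 4 (branch 0 1 (falsify 15)
       (branch 1 3 (falsify 15) (branch 1 2 (falsify 15) (branch 2 3 (branch 0 3 (falsify 17) (falsify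
       10)) (falsify 8))))) (branch 0 5 (branch 2 5 (branch 2 3 (falsify 16) (branch 0 1 (falsify 8)
       (branch 1 2 (branch 0 2 (branch 0 3 (falsify 16) (branch 1 3 (falsify 16) (falsify 10))) (falsify
       9)) (falsify 8)))) (branch 0 1 (branch 1 2 (falsify 17) (branch 0 2 (falsify 15) (falsify 11)))
       (branch 2 3 (branch 0 3 (falsify 17) (branch 1 3 (falsify 15) (falsify 10))) (branch 0 2 (branch 1
       2 (branch 1 3 (falsify 16) (branch 0 3 (falsify 16) (falsify 10))) (falsify 8)) (falsify 9)))))
       (falsify 20)))) (falsify 19)) (falsify 19)))) (branch 5 6 (branch 4 6 (falsify 5) (branch 0 5
       (falsify 4) (branch 3 4 (branch 3 6 (falsify 7) (falsify 19)) (falsify 19)))) (falsify 18)))))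
       (branch 1 4 (branch 1 5 (falsify 1) (branch 5 6 (falsify 5) (branch 4 5 (falsify 5) (branch 2 5
       (branch 2 4 (branch 4 6 (falsify 6) (branch 0 6 (branch 0 5 (branch 3 4 (branch 0 1 (falsify 15)
       (branch 0 3 (falsify 15) (branch 1 2 (falsify 9) (branch 0 2 (falsify 15) (falsify 11))))) (branch
       3 6 (branch 0 2 (falsify 17) (branch 2 3 (falsify 17) (branch 0 1 (falsify 8) (branch 1 2 (falsify
       17) (falsify 11))))) (branch 0 2 (branch 2 3 (falsify 15) (branch 0 3 (falsify 17) (falsify 9)))
       (branch 1 3 (branch 0 1 (falsify 15) (branch 1 2 (falsify 17) (falsify 11))) (branch 0 3 (branch 2
       3 (branch 0 1 (falsify 16) (branch 1 2 (falsify 16) (falsify 11))) (falsify 8)) (falsify 10))))))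
       (falsify 18)) (falsify 18))) (falsify 20)) (falsify 20))))) (branch 1 5 (branch 4 5 (falsify 5)
       (branch 4 6 (falsify 5) (branch 3 4 (branch 3 6 (branch 5 6 (falsify 7) (branch 2 4 (branch 2 5
       (branch 0 5 (branch 2 3 (falsify 16) (branch 1 3 (falsify 16) (branch 0 3 (falsify 16) (branch 1 2
       (falsify 9) (falsify 8))))) (branch 0 6 (branch 1 2 (falsify 17) (branch 2 3 (falsify 17) (branch
       0 2 (falsify 17) (branch 1 3 (falsify 9) (falsify 8))))) (branch 0 1 (branch 1 2 (falsify 17)
       (branch 1 3 (falsify 16) (branch 2 3 (branch 0 2 (falsify 16) (branch 0 3 (falsify 17) (falsify
       9))) (falsify 8)))) (branch 2 3 (falsify 10) (branch 0 2 (branch 1 2 (falsify 15) (branch 1 3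
       (branch 0 3 (falsify 15) (falsify 10)) (falsify 8))) (falsify 11)))))) (falsify 20)) (falsify
       20))) (falsify 19)) (falsify 19)))) (branch 4 6 (branch 5 6 (falsify 5) (branch 0 5 (branch 0 6
       (falsify 4) (falsify 18)) (falsify 18))) (branch 3 4 (branch 3 6 (branch 4 5 (falsify 7) (branch 5
       6 (falsify 7) (branch 0 6 (branch 0 5 (branch 2 3 (falsify 17) (branch 2 5 (branch 2 4 (branch 0 2
       (falsify 17) (branch 1 2 (falsify 17) (branch 0 3 (falsify 8) (falsify 9)))) (falsify 8)) (falsify
       20))) (falsify 18)) (falsify 18)))) (falsify 19)) (falsify 19)))))))) (branch 2 5 (branch 3 4
       (branch 0 5 (branch 0 4 (branch 0 6 (falsify 0) (branch 4 6 (falsify 4) (branch 5 6 (falsify 4)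
       (branch 3 5 (falsify 19) (branch 2 4 (falsify 18) (branch 3 6 (branch 4 5 (falsify 7) (branch 2 6
       (branch 1 5 (branch 1 3 (falsify 16) (branch 0 2 (falsify 8) (branch 1 2 (branch 1 4 (falsify 15)
       (branch 0 1 (branch 0 3 (falsify 16) (branch 2 3 (falsify 16) (falsify 9))) (falsify 10)))
       (falsify 8)))) (branch 1 4 (branch 2 3 (falsify 15) (branch 0 2 (falsify 15) (branch 1 2 (falsify
       15) (branch 0 3 (falsify 8) (falsify 9))))) (branch 0 1 (branch 0 3 (falsify 16) (branch 0 2
       (falsify 15) (branch 2 3 (branch 1 3 (falsify 15) (branch 1 2 (falsify 16) (falsify 8))) (falsify
       9)))) (branch 2 3 (falsify 10) (branch 1 2 (branch 1 3 (branch 0 2 (falsify 17) (branch 0 3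
       (falsify 17) (falsify 9))) (falsify 10)) (falsify 11)))))) (falsify 18))) (falsify 19)))))))
       (branch 3 5 (branch 4 6 (falsify 7) (falsify 19)) (branch 1 5 (branch 1 3 (falsify 16) (branch 0 3
       (falsify 16) (branch 2 3 (falsify 16) (branch 0 1 (branch 3 6 (branch 4 5 (falsify 7) (branch 5 6
       (falsify 7) (branch 4 6 (branch 2 6 (falsify 6) (branch 2 4 (falsify 6) (falsify 8))) (branch 2 4
       (branch 2 6 (falsify 2) (branch 0 2 (falsify 10) (falsify 9))) (branch 2 6 (branch 1 2 (falsify
       10) (falsify 8)) (falsify 8)))))) (branch 1 4 (falsify 9) (falsify 10))) (falsify 10))))) (branch
       3 6 (branch 4 5 (falsify 7) (branch 2 6 (falsify 20) (branch 2 4 (branch 4 6 (falsify 6) (branch 5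
       6 (falsify 6) (branch 0 6 (branch 1 4 (branch 0 3 (falsify 15) (branch 0 1 (falsify 15) (branch 2
       3 (falsify 10) (branch 0 2 (falsify 15) (falsify 9))))) (branch 2 3 (branch 1 2 (falsify 16)
       (branch 1 3 (falsify 17) (falsify 8))) (branch 0 1 (branch 0 3 (falsify 16) (branch 0 2 (falsify
       17) (falsify 9))) (branch 1 2 (branch 0 2 (falsify 15) (branch 0 3 (branch 1 3 (falsify 15)
       (falsify 10)) (falsify 9))) (falsify 11))))) (falsify 18)))) (falsify 20)))) (branch 4 5 (falsify
       19) (branch 4 6 (branch 2 4 (falsify 6) (falsify 20)) (falsify 19))))))) (branch 2 4 (branch 5 6
       (falsify 6) (falsify 18)) (branch 2 6 (branch 4 5 (falsify 6) (branch 4 6 (falsify 6) (branch 5 6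
       (branch 3 6 (falsify 7) (branch 3 5 (falsify 7) (branch 0 6 (branch 0 4 (falsify 4) (falsify 19))
       (falsify 19)))) (branch 3 6 (branch 3 5 (falsify 3) (branch 1 5 (branch 1 4 (branch 0 4 (branch 2
       3 (falsify 15) (branch 1 2 (falsify 15) (branch 0 2 (falsify 15) (branch 1 3 (falsify 11) (falsify
       8))))) (branch 0 6 (branch 1 3 (falsify 17) (branch 0 1 (falsify 17) (branch 2 3 (falsify 10)
       (branch 1 2 (falsify 17) (falsify 8))))) (branch 0 2 (branch 1 2 (falsify 17) (branch 2 3 (falsify
       16) (branch 1 3 (branch 0 3 (falsify 17) (branch 0 1 (falsify 16) (falsify 10))) (falsify 8))))
       (branch 1 3 (falsify 9) (branch 0 3 (branch 2 3 (falsify 15) (branch 0 1 (branch 1 2 (falsify 15)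
       (falsify 8)) (falsify 11))) (falsify 9)))))) (falsify 20)) (falsify 20))) (branch 0 6 (branch 0 4
       (branch 3 5 (branch 1 5 (branch 0 1 (falsify 16) (branch 2 3 (falsify 11) (branch 1 2 (branch 1 4
       (falsify 15) (branch 1 3 (branch 0 3 (falsify 16) (branch 0 2 (falsify 16) (falsify 9))) (falsify
       10))) (falsify 11)))) (branch 1 4 (branch 0 2 (falsify 15) (branch 1 2 (falsify 15) (branch 0 3
       (falsify 8) (branch 2 3 (falsify 15) (falsify 9))))) (branch 1 2 (branch 2 3 (falsify 17) (branch
       0 2 (falsify 16) (branch 0 3 (branch 0 1 (falsify 17) (branch 1 3 (falsify 16) (falsify 10)))
       (falsify 9)))) (branch 0 3 (falsify 8) (branch 0 1 (branch 1 3 (branch 2 3 (falsify 15) (branch 0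
       2 (falsify 15) (falsify 9))) (falsify 8)) (falsify 11)))))) (branch 1 4 (branch 1 5 (branch 0 2
       (falsify 15) (branch 2 3 (falsify 15) (branch 0 1 (falsify 8) (branch 1 2 (falsify 15) (falsify
       11))))) (falsify 20)) (falsify 20))) (falsify 19)) (falsify 19)))))) (branch 5 6 (branch 4 5
       (falsify 6) (branch 3 5 (falsify 7) (branch 3 6 (falsify 7) (branch 1 5 (branch 1 4 (falsify 5)
       (falsify 20)) (falsify 20))))) (falsify 18))))) (branch 0 5 (branch 4 6 (branch 2 6 (falsify 6)
       (branch 0 6 (falsify 4) (branch 0 4 (falsify 4) (branch 1 3 (branch 1 5 (falsify 16) (branch 3 5
       (falsify 16) (branch 4 5 (falsify 18) (branch 2 4 (falsify 6) (falsify 20))))) (falsify 10)))))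
       (falsify 19)) (branch 2 4 (branch 2 6 (falsify 2) (branch 5 6 (falsify 6) (branch 4 6 (falsify 6)
       (branch 3 5 (branch 3 6 (branch 4 5 (falsify 7) (branch 0 6 (branch 0 4 (branch 1 4 (branch 1 3
       (falsify 15) (branch 0 2 (falsify 10) (branch 0 1 (branch 1 5 (falsify 16) (branch 1 2 (branch 2 3
       (falsify 15) (branch 0 3 (falsify 15) (falsify 9))) (falsify 8))) (falsify 10)))) (branch 1 5
       (branch 0 3 (falsify 16) (branch 0 2 (falsify 16) (branch 0 1 (falsify 16) (branch 2 3 (falsify
       10) (falsify 9))))) (branch 1 3 (branch 0 3 (falsify 16) (branch 2 3 (falsify 17) (branch 0 2
       (branch 1 2 (falsify 16) (branch 0 1 (falsify 17) (falsify 11))) (falsify 9)))) (branch 0 2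
       (falsify 8) (branch 1 2 (branch 0 1 (branch 0 3 (falsify 15) (branch 2 3 (falsify 15) (falsify
       9))) (falsify 10)) (falsify 8)))))) (falsify 19)) (falsify 19))) (falsify 18)) (falsify 18)))))
       (branch 2 6 (branch 4 6 (falsify 6) (branch 4 5 (falsify 6) (branch 0 4 (branch 0 6 (branch 5 6
       (falsify 4) (branch 1 4 (branch 1 5 (branch 3 5 (branch 0 2 (falsify 16) (branch 0 1 (falsify 16)
       (branch 0 3 (falsify 16) (branch 1 2 (falsify 10) (falsify 11))))) (branch 3 6 (branch 1 3
       (falsify 17) (branch 0 2 (falsify 8) (branch 2 3 (branch 0 3 (branch 0 1 (falsify 17) (branch 1 2
       (falsify 17) (falsify 11))) (falsify 10)) (falsify 8)))) (branch 0 1 (branch 0 3 (falsify 17)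
       (branch 1 3 (falsify 16) (falsify 10))) (branch 2 3 (branch 1 2 (falsify 17) (branch 0 2 (falsify
       16) (falsify 11))) (branch 1 3 (branch 0 3 (branch 0 2 (falsify 15) (branch 1 2 (falsify 15)
       (falsify 11))) (falsify 9)) (falsify 8)))))) (falsify 20)) (falsify 20))) (falsify 19)) (falsify
       19)))) (branch 5 6 (branch 4 5 (falsify 6) (branch 1 5 (branch 1 4 (falsify 5) (falsify 20))
       (falsify 20))) (branch 3 6 (branch 3 5 (branch 4 6 (falsify 7) (branch 4 5 (falsify 7) (branch 1 5
       (branch 1 4 (branch 0 4 (branch 0 6 (branch 0 3 (falsify 16) (branch 0 1 (falsify 16) (branch 0 2
       (falsify 16) (branch 1 3 (falsify 9) (falsify 10))))) (falsify 19)) (falsify 19)) (falsify 20))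
       (falsify 20)))) (falsify 18)) (falsify 18))))))) (branch 0 4 (branch 3 4 (branch 5 6 (branch 0 6
       (falsify 4) (branch 3 6 (falsify 7) (branch 0 5 (falsify 4) (branch 1 2 (branch 1 4 (falsify 15)
       (branch 2 4 (falsify 15) (branch 4 5 (falsify 19) (branch 3 5 (falsify 7) (falsify 20)))))
       (falsify 11))))) (falsify 18)) (branch 0 6 (branch 0 5 (falsify 0) (branch 4 5 (falsify 4) (branch
       5 6 (falsify 4) (branch 3 6 (branch 3 5 (branch 4 6 (falsify 7) (branch 1 5 (branch 1 4 (branch 2
       4 (branch 0 3 (falsify 15) (branch 1 3 (falsify 15) (branch 2 3 (falsify 15) (branch 0 1 (falsify
       8) (falsify 10))))) (branch 2 6 (branch 1 3 (falsify 17) (branch 0 1 (falsify 17) (branch 1 2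
       (falsify 17) (branch 0 3 (falsify 8) (falsify 10))))) (branch 0 2 (branch 0 3 (falsify 15) (branch
       0 1 (falsify 17) (branch 1 3 (branch 2 3 (falsify 17) (branch 1 2 (falsify 15) (falsify 8)))
       (falsify 10)))) (branch 1 3 (falsify 9) (branch 1 2 (branch 2 3 (branch 0 1 (falsify 16) (branch 0
       3 (falsify 16) (falsify 10))) (falsify 9)) (falsify 11)))))) (falsify 20)) (falsify 20))) (falsify
       18)) (falsify 18))))) (branch 0 5 (branch 4 6 (falsify 4) (branch 5 6 (falsify 4) (branch 2 6
       (branch 2 4 (branch 4 5 (falsify 6) (branch 3 5 (branch 3 6 (branch 1 5 (branch 1 2 (falsify 16)
       (branch 0 3 (falsify 8) (branch 1 3 (branch 1 4 (falsify 15) (branch 0 1 (branch 0 2 (falsify 16)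
       (branch 2 3 (falsify 16) (falsify 9))) (falsify 11))) (falsify 8)))) (branch 1 4 (branch 2 3
       (falsify 15) (branch 0 3 (falsify 15) (branch 1 3 (falsify 15) (branch 0 2 (falsify 8) (falsify
       9))))) (branch 0 1 (branch 0 3 (falsify 15) (branch 0 2 (falsify 16) (branch 2 3 (branch 1 2
       (falsify 15) (branch 1 3 (falsify 16) (falsify 8))) (falsify 9)))) (branch 2 3 (falsify 10)
       (branch 1 2 (branch 0 2 (falsify 17) (branch 0 3 (branch 1 3 (falsify 17) (falsify 10)) (falsify
       9))) (falsify 11)))))) (falsify 18)) (falsify 18))) (falsify 19)) (falsify 19)))) (branch 4 6
       (branch 4 5 (falsify 4) (branch 1 5 (branch 1 4 (falsify 5) (falsify 20)) (falsify 20))) (branch 2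
       6 (branch 2 4 (branch 4 5 (falsify 6) (branch 5 6 (falsify 6) (branch 1 4 (branch 1 5 (branch 0 3
       (falsify 15) (branch 1 2 (falsify 9) (branch 2 3 (falsify 15) (branch 1 3 (falsify 15) (falsify
       8))))) (falsify 20)) (falsify 20)))) (falsify 19)) (falsify 19)))))) (branch 3 4 (branch 3 6
       (branch 3 5 (falsify 3) (branch 4 5 (falsify 7) (branch 5 6 (falsify 7) (branch 0 6 (branch 0 5
       (branch 4 6 (falsify 4) (branch 1 5 (branch 1 4 (branch 2 6 (branch 0 1 (falsify 17) (branch 1 3
       (falsify 17) (branch 1 2 (falsify 17) (branch 0 3 (falsify 11) (falsify 10))))) (branch 2 4
       (branch 0 3 (falsify 15) (branch 0 1 (falsify 15) (branch 0 2 (falsify 15) (branch 1 3 (falsify 9)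
       (falsify 10))))) (branch 2 3 (branch 1 3 (falsify 17) (branch 0 3 (falsify 15) (branch 0 1 (branch
       1 2 (falsify 15) (branch 0 2 (falsify 17) (falsify 11))) (falsify 10)))) (branch 0 1 (falsify 8)
       (branch 0 2 (branch 1 2 (branch 1 3 (falsify 16) (branch 0 3 (falsify 16) (falsify 10))) (falsify
       8)) (falsify 9)))))) (falsify 20)) (falsify 20))) (falsify 18)) (falsify 18))))) (branch 3 5
       (branch 4 6 (falsify 7) (branch 5 6 (falsify 7) (branch 2 4 (branch 2 6 (branch 4 5 (falsify 6)
       (branch 0 6 (branch 0 5 (branch 1 4 (branch 0 2 (falsify 15) (branch 0 3 (falsify 15) (branch 0 1
       (falsify 15) (branch 2 3 (falsify 11) (falsify 9))))) (branch 1 5 (branch 0 2 (falsify 16) (branch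
       2 3 (falsify 16) (branch 1 2 (falsify 16) (branch 0 3 (falsify 8) (falsify 9))))) (branch 0 1
       (branch 0 2 (falsify 16) (branch 0 3 (falsify 17) (branch 2 3 (branch 1 2 (falsify 17) (branch 1 3
       (falsify 16) (falsify 8))) (falsify 9)))) (branch 2 3 (falsify 10) (branch 1 3 (branch 1 2 (branch
       0 3 (falsify 15) (branch 0 2 (falsify 15) (falsify 9))) (falsify 11)) (falsify 10)))))) (falsify
       18)) (falsify 18))) (falsify 19)) (falsify 19)))) (branch 4 5 (branch 4 6 (falsify 7) (branch 2 6
       (branch 2 4 (falsify 6) (falsify 19)) (falsify 19))) (branch 1 4 (branch 1 5 (branch 5 6 (falsify
       5) (branch 4 6 (falsify 5) (branch 2 4 (branch 2 6 (branch 0 5 (branch 0 6 (branch 0 1 (falsify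
       15) (branch 0 3 (falsify 15) (branch 1 2 (falsify 9) (branch 0 2 (falsify 15) (falsify 11)))))
       (falsify 18)) (falsify 18)) (falsify 19)) (falsify 19)))) (falsify 20)) (falsify 20))))) (branch 1
       4 (branch 1 5 (branch 4 6 (falsify 5) (branch 5 6 (falsify 5) (branch 2 6 (branch 2 4 (branch 4 5
       (falsify 6) (branch 0 1 (branch 1 3 (falsify 15) (branch 2 3 (branch 0 2 (falsify 15) (branch 0 6
       (branch 1 2 (falsify 17) (branch 3 6 (falsify 17) (branch 0 5 (branch 3 5 (falsify 16) (branch 0 3
       (falsify 17) (falsify 10))) (falsify 18)))) (branch 3 5 (branch 0 3 (falsify 16) (falsify 9))
       (falsify 18)))) (branch 0 2 (falsify 8) (branch 0 6 (falsify 8) (branch 1 2 (branch 3 5 (falsify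
       16) (falsify 18)) (falsify 8)))))) (branch 1 3 (branch 2 3 (branch 0 2 (falsify 15) (falsify 11))
       (branch 0 5 (branch 1 2 (falsify 16) (branch 0 2 (branch 3 5 (falsify 16) (branch 0 3 (falsify 16)
       (branch 0 6 (branch 3 6 (falsify 17) (falsify 9)) (falsify 18)))) (falsify 11))) (branch 0 3
       (branch 3 6 (falsify 17) (falsify 18)) (falsify 10)))) (branch 2 3 (branch 0 2 (falsify 15)
       (branch 3 5 (falsify 11) (branch 1 2 (branch 0 6 (falsify 17) (falsify 18)) (falsify 11))))
       (branch 1 2 (branch 3 6 (branch 0 2 (falsify 17) (branch 0 6 (falsify 17) (branch 3 5 (falsify 11)
       (falsify 18)))) (branch 0 5 (falsify 8) (falsify 18))) (falsify 8)))))) (falsify 19)) (falsify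
       19)))) (branch 4 5 (branch 4 6 (falsify 5) (branch 2 4 (branch 2 6 (falsify 6) (falsify 19))
       (falsify 19))) (falsify 20))) (branch 4 5 (branch 1 2 (branch 1 5 (branch 5 6 (falsify 5) (branch
       2 4 (branch 2 6 (falsify 6) (branch 4 6 (falsify 6) (falsify 19))) (branch 4 6 (branch 0 5 (branch
       3 5 (falsify 16) (branch 0 6 (falsify 4) (falsify 18))) (branch 3 6 (branch 3 5 (falsify 7)
       (falsify 18)) (falsify 18))) (falsify 19)))) (branch 2 3 (branch 0 2 (falsify 10) (branch 3 6
       (falsify 11) (branch 0 3 (falsify 11) (branch 1 3 (falsify 9) (branch 2 6 (branch 0 6 (falsify 17)
       (falsify 11)) (falsify 11)))))) (branch 2 6 (branch 2 4 (falsify 6) (branch 5 6 (falsify 19)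
       (branch 4 6 (branch 0 6 (falsify 8) (branch 3 6 (branch 3 5 (falsify 7) (falsify 18)) (falsify
       8))) (falsify 19)))) (falsify 8)))) (branch 0 3 (falsify 8) (branch 5 6 (branch 2 6 (falsify 20)
       (falsify 19)) (branch 0 5 (branch 0 6 (falsify 4) (branch 3 5 (falsify 11) (falsify 18))) (branch
       3 6 (falsify 11) (falsify 18)))))) (falsify 20)))))))
      tt
  indexedConfiguration-unsatisfiable₇ 5 _ refl = refutation-unsatisfiable
      (branch 1 6 (branch 1 5 (falsify 1) (branch 5 6 (falsify 6) (branch 4 6 (branch 4 5 (falsify 4)
       (branch 0 6 (branch 0 5 (falsify 0) (branch 3 6 (branch 1 2 (falsify 18) (falsify 13)) (branch 2 6
       (branch 1 3 (falsify 18) (falsify 12)) (branch 2 5 (branch 3 5 (branch 1 4 (branch 3 4 (branch 2 4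
       (falsify 14) (branch 1 3 (falsify 11) (falsify 10))) (branch 0 2 (falsify 10) (falsify 11)))
       (branch 2 3 (branch 0 3 (branch 0 2 (falsify 10) (branch 3 4 (falsify 14) (falsify 11))) (branch 2
       4 (falsify 14) (falsify 11))) (branch 0 2 (branch 0 3 (falsify 10) (branch 2 4 (falsify 14)
       (falsify 11))) (branch 1 3 (falsify 11) (falsify 14))))) (branch 2 4 (falsify 14) (falsify 10)))
       (branch 1 3 (falsify 11) (falsify 10)))))) (branch 3 6 (branch 3 5 (falsify 3) (branch 2 6 (branch
       0 4 (falsify 18) (falsify 12)) (branch 2 5 (branch 2 4 (branch 0 4 (falsify 14) (branch 1 2
       (falsify 11) (falsify 13))) (branch 0 3 (falsify 13) (falsify 11))) (branch 0 1 (falsify 11)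
       (falsify 13))))) (branch 2 6 (branch 2 5 (falsify 2) (branch 0 5 (branch 0 2 (branch 2 3 (falsify
       12) (branch 0 4 (falsify 14) (falsify 11))) (branch 1 3 (falsify 11) (falsify 14))) (branch 1 3
       (falsify 11) (falsify 12)))) (branch 2 5 (branch 1 2 (branch 3 4 (branch 2 4 (falsify 12) (branch
       0 4 (branch 1 3 (branch 0 1 (falsify 11) (falsify 13)) (falsify 10)) (falsify 12))) (falsify 12))
       (branch 0 4 (branch 3 4 (falsify 14) (falsify 10)) (falsify 13))) (branch 3 5 (branch 1 4 (branch
       0 5 (branch 1 2 (branch 3 4 (branch 1 3 (falsify 13) (branch 0 4 (falsify 10) (falsify 12)))
       (branch 0 1 (falsify 10) (falsify 12))) (branch 3 4 (falsify 13) (falsify 10))) (branch 3 4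
       (falsify 14) (falsify 11))) (branch 0 4 (branch 1 3 (branch 3 4 (falsify 13) (branch 0 1 (falsify
       10) (falsify 12))) (falsify 10)) (branch 1 3 (falsify 11) (falsify 12)))) (branch 0 4 (falsify 14)
       (falsify 11)))))))) (branch 3 6 (branch 3 5 (falsify 3) (branch 0 6 (branch 0 5 (falsify 0)
       (branch 2 6 (branch 1 4 (falsify 18) (falsify 12)) (branch 2 5 (branch 1 3 (branch 0 4 (branch 0 2
       (falsify 10) (branch 1 4 (falsify 11) (falsify 13))) (branch 1 2 (falsify 11) (falsify 13)))
       (branch 0 2 (branch 0 4 (falsify 10) (branch 1 2 (falsify 11) (falsify 13))) (branch 1 4 (falsify
       11) (falsify 13)))) (branch 0 4 (falsify 10) (falsify 11))))) (branch 2 5 (branch 2 6 (falsify 2)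
       (branch 2 3 (branch 1 4 (branch 1 2 (falsify 12) (branch 0 1 (branch 0 3 (branch 3 4 (falsify 13)
       (falsify 10)) (falsify 14)) (falsify 12))) (falsify 12)) (branch 0 1 (branch 1 4 (falsify 11)
       (falsify 10)) (falsify 14)))) (branch 0 5 (branch 3 4 (branch 0 1 (branch 2 4 (branch 0 3 (falsify
       13) (branch 1 4 (falsify 11) (falsify 12))) (falsify 11)) (falsify 13)) (branch 0 1 (falsify 11)
       (falsify 12))) (branch 1 4 (falsify 11) (falsify 13)))))) (branch 0 6 (branch 0 5 (falsify 0)
       (branch 2 5 (branch 2 6 (falsify 2) (branch 2 4 (branch 0 2 (branch 1 3 (branch 1 2 (falsify 12)
       (branch 1 4 (branch 0 4 (branch 0 3 (falsify 10) (falsify 14)) (falsify 13)) (falsify 12)))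
       (falsify 12)) (branch 1 3 (branch 1 4 (falsify 11) (falsify 13)) (falsify 14))) (branch 0 2
       (branch 1 3 (branch 1 4 (branch 1 2 (falsify 11) (branch 0 4 (branch 0 3 (falsify 10) (falsify
       14)) (falsify 13))) (falsify 12)) (falsify 12)) (branch 1 4 (branch 1 3 (falsify 11) (falsify 14))
       (falsify 13))))) (branch 4 5 (branch 2 4 (branch 0 4 (branch 3 5 (branch 1 4 (falsify 14) (branch
       0 3 (falsify 10) (falsify 12))) (falsify 10)) (branch 1 3 (falsify 11) (falsify 12))) (branch 1 3
       (falsify 11) (falsify 10))) (branch 0 3 (falsify 10) (falsify 11))))) (branch 2 5 (branch 2 6
       (falsify 2) (branch 1 2 (falsify 12) (branch 4 5 (falsify 14) (branch 0 5 (falsify 10) (falsify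
       13))))) (branch 4 5 (branch 3 5 (branch 0 1 (branch 0 5 (branch 0 2 (falsify 10) (branch 1 4
       (falsify 14) (falsify 13))) (branch 3 4 (branch 0 4 (branch 2 3 (branch 1 4 (branch 2 4 (falsify
       14) (branch 0 3 (falsify 10) (falsify 11))) (falsify 12)) (falsify 10)) (branch 1 3 (falsify 11)
       (falsify 12))) (branch 0 3 (branch 2 4 (branch 1 3 (branch 2 3 (falsify 13) (branch 1 4 (falsify
       11) (falsify 10))) (falsify 12)) (falsify 10)) (branch 1 4 (falsify 11) (falsify 12))))) (branch 2
       3 (falsify 13) (falsify 14))) (branch 2 4 (branch 0 1 (branch 3 4 (branch 1 3 (branch 1 4 (falsify
       11) (branch 0 2 (falsify 10) (falsify 13))) (falsify 14)) (falsify 11)) (falsify 12)) (branch 0 1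
       (falsify 10) (falsify 13)))) (branch 0 5 (branch 0 2 (branch 1 3 (branch 0 1 (falsify 10) (branch
       2 3 (falsify 12) (falsify 14))) (falsify 10)) (branch 1 3 (falsify 11) (falsify 14))) (branch 1 3
       (falsify 11) (falsify 12)))))))))) (branch 1 5 (branch 5 6 (falsify 6) (branch 4 5 (branch 4 6
       (falsify 4) (branch 0 5 (branch 0 6 (falsify 0) (branch 3 5 (branch 0 2 (falsify 17) (falsify 13))
       (branch 2 5 (branch 3 4 (falsify 17) (falsify 12)) (branch 3 6 (branch 0 3 (branch 0 2 (falsify
       10) (branch 3 4 (falsify 14) (falsify 11))) (branch 2 4 (falsify 14) (falsify 11))) (branch 1 2
       (falsify 11) (falsify 10)))))) (branch 3 6 (branch 3 5 (falsify 3) (branch 2 6 (branch 2 5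
       (falsify 2) (branch 0 2 (branch 1 4 (branch 2 4 (branch 1 2 (falsify 12) (branch 3 4 (falsify 13)
       (falsify 10))) (branch 1 3 (falsify 13) (falsify 10))) (branch 1 3 (branch 0 4 (branch 2 4 (branch
       3 4 (falsify 13) (branch 0 1 (falsify 10) (falsify 12))) (falsify 13)) (falsify 13)) (branch 0 4
       (falsify 10) (falsify 12)))) (branch 0 1 (branch 0 6 (branch 0 4 (falsify 10) (branch 1 3 (falsify
       13) (falsify 12))) (branch 3 4 (falsify 14) (falsify 11))) (branch 2 4 (falsify 12) (falsify
       13))))) (branch 1 3 (branch 0 6 (branch 0 1 (falsify 11) (branch 3 4 (falsify 14) (falsify 12)))
       (falsify 11)) (branch 0 4 (falsify 14) (falsify 12))))) (branch 2 5 (branch 2 6 (falsify 2)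
       (branch 0 2 (falsify 12) (falsify 11))) (branch 2 6 (branch 2 4 (branch 0 6 (branch 0 4 (falsify
       14) (branch 1 2 (falsify 11) (falsify 13))) (falsify 14)) (branch 0 1 (falsify 11) (falsify 13)))
       (branch 0 4 (falsify 14) (falsify 11))))))) (branch 3 5 (branch 3 6 (falsify 3) (branch 2 5
       (branch 2 6 (falsify 2) (branch 0 5 (branch 1 4 (falsify 17) (falsify 10)) (branch 0 6 (branch 0 3
       (branch 3 4 (falsify 13) (branch 0 1 (falsify 11) (falsify 12))) (branch 1 4 (falsify 11) (falsify
       12))) (branch 2 4 (falsify 12) (falsify 11))))) (branch 0 6 (branch 0 5 (falsify 0) (branch 0 3
       (branch 1 2 (branch 0 1 (falsify 10) (branch 1 4 (branch 2 3 (branch 3 4 (falsify 13) (falsify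
       12)) (falsify 14)) (falsify 10))) (falsify 10)) (branch 1 2 (branch 1 4 (falsify 11) (falsify 12))
       (falsify 14)))) (branch 2 6 (branch 0 1 (branch 0 5 (branch 3 4 (branch 2 3 (falsify 13) (branch 1
       4 (falsify 11) (falsify 10))) (branch 0 2 (falsify 10) (falsify 11))) (branch 2 3 (branch 3 4
       (falsify 13) (branch 1 2 (falsify 11) (falsify 10))) (branch 1 4 (falsify 11) (falsify 10))))
       (branch 2 4 (branch 0 2 (branch 4 6 (branch 2 3 (branch 1 2 (falsify 12) (branch 3 4 (falsify 13)
       (falsify 10))) (branch 1 4 (falsify 11) (falsify 10))) (branch 2 3 (falsify 13) (falsify 11)))
       (branch 1 4 (falsify 11) (falsify 13))) (branch 4 6 (branch 1 3 (branch 2 3 (branch 0 5 (branch 3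
       4 (falsify 13) (branch 0 2 (falsify 10) (falsify 11))) (falsify 12)) (branch 1 4 (falsify 11)
       (falsify 10))) (branch 0 4 (branch 0 2 (branch 0 5 (falsify 10) (branch 2 3 (falsify 12) (falsify
       14))) (branch 1 4 (falsify 11) (falsify 13))) (branch 1 2 (falsify 11) (falsify 13)))) (falsify
       11)))) (branch 1 4 (falsify 11) (falsify 13)))))) (branch 0 5 (branch 0 6 (falsify 0) (branch 2 6
       (branch 2 5 (falsify 2) (branch 0 2 (branch 1 3 (branch 1 4 (branch 1 2 (falsify 11) (branch 0 4
       (branch 0 3 (falsify 10) (falsify 14)) (falsify 13))) (falsify 12)) (falsify 12)) (branch 1 4
       (branch 1 3 (falsify 11) (falsify 14)) (falsify 13)))) (branch 3 6 (branch 2 5 (branch 0 4 (branch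
       0 3 (falsify 10) (branch 2 4 (falsify 12) (falsify 11))) (branch 2 3 (falsify 12) (falsify 11)))
       (branch 1 3 (branch 2 4 (branch 0 4 (branch 0 2 (branch 0 3 (falsify 10) (branch 1 4 (falsify 11)
       (falsify 12))) (falsify 13)) (falsify 11)) (falsify 11)) (branch 0 4 (falsify 10) (falsify 12))))
       (branch 0 4 (falsify 10) (falsify 11))))) (branch 2 5 (branch 2 6 (falsify 2) (branch 4 6 (branch
       0 3 (branch 0 1 (branch 2 4 (branch 1 4 (falsify 14) (branch 0 2 (falsify 10) (falsify 13)))
       (falsify 10)) (branch 2 4 (falsify 14) (falsify 13))) (branch 1 3 (branch 3 6 (branch 0 2 (branch
       2 4 (branch 2 3 (falsify 12) (branch 1 4 (falsify 14) (falsify 10))) (falsify 13)) (falsify 13))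
       (branch 1 4 (falsify 11) (falsify 12))) (branch 2 4 (falsify 14) (falsify 10)))) (branch 3 6
       (branch 2 4 (branch 0 1 (branch 1 3 (falsify 11) (branch 0 4 (falsify 14) (falsify 12))) (branch 3
       4 (falsify 14) (falsify 12))) (branch 1 3 (falsify 13) (falsify 10))) (branch 0 1 (falsify 11)
       (falsify 12))))) (branch 4 6 (branch 1 4 (falsify 14) (branch 1 3 (branch 1 2 (branch 0 1 (branch
       0 6 (falsify 10) (branch 2 6 (falsify 12) (falsify 13))) (falsify 14)) (falsify 14)) (falsify
       14))) (branch 1 4 (branch 0 6 (branch 0 1 (falsify 10) (branch 2 6 (falsify 12) (falsify 13)))
       (branch 1 3 (branch 1 2 (falsify 11) (falsify 13)) (falsify 12))) (branch 0 6 (falsify 10) (branch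
       3 6 (falsify 13) (falsify 12)))))))))) (branch 0 6 (branch 0 5 (falsify 0) (branch 5 6 (falsify 5)
       (branch 3 6 (branch 3 5 (falsify 3) (branch 4 6 (branch 4 5 (falsify 4) (branch 2 4 (falsify 14)
       (falsify 10))) (branch 2 5 (branch 2 6 (falsify 2) (branch 2 4 (branch 0 1 (branch 1 4 (branch 2 3
       (branch 0 4 (branch 0 2 (falsify 10) (branch 1 3 (falsify 11) (falsify 14))) (falsify 12))
       (falsify 11)) (branch 0 2 (falsify 10) (falsify 13))) (branch 3 4 (falsify 14) (falsify 12)))
       (branch 4 5 (branch 1 4 (branch 2 3 (branch 0 1 (branch 3 4 (falsify 13) (branch 0 2 (falsify 10)
       (falsify 11))) (falsify 12)) (branch 0 4 (falsify 10) (falsify 11))) (branch 2 3 (falsify 13)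
       (falsify 10))) (falsify 10)))) (branch 0 4 (falsify 10) (falsify 13))))) (branch 4 5 (branch 4 6
       (falsify 4) (branch 2 6 (branch 2 5 (falsify 2) (branch 2 4 (branch 2 3 (falsify 12) (branch 0 4
       (falsify 10) (falsify 11))) (branch 0 3 (falsify 10) (falsify 11)))) (branch 0 4 (falsify 14)
       (branch 2 5 (falsify 12) (falsify 13))))) (branch 2 6 (branch 2 5 (falsify 2) (branch 0 3 (falsify
       10) (falsify 12))) (branch 3 5 (branch 1 4 (branch 0 1 (branch 4 6 (branch 2 5 (branch 0 3 (branch
       0 2 (falsify 10) (branch 3 4 (falsify 13) (falsify 11))) (branch 2 4 (falsify 12) (falsify 11)))
       (branch 0 3 (falsify 10) (falsify 11))) (branch 0 3 (falsify 13) (falsify 12))) (branch 3 4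
       (falsify 13) (falsify 12))) (branch 0 3 (falsify 13) (falsify 12))) (branch 0 2 (falsify 10)
       (falsify 14)))))))) (branch 0 5 (branch 5 6 (falsify 5) (branch 3 6 (branch 3 5 (falsify 3)
       (branch 4 6 (branch 4 5 (falsify 4) (branch 2 6 (branch 2 5 (falsify 2) (branch 0 3 (falsify 13)
       (falsify 12))) (branch 1 3 (branch 1 2 (branch 0 4 (branch 2 5 (branch 2 4 (falsify 14) (branch 0
       3 (falsify 10) (falsify 11))) (falsify 14)) (falsify 11)) (branch 0 4 (falsify 14) (falsify 13)))
       (branch 0 4 (falsify 10) (falsify 12))))) (branch 2 5 (branch 2 6 (falsify 2) (branch 2 3 (falsify
       12) (falsify 10))) (branch 3 4 (branch 0 2 (branch 0 1 (branch 0 3 (falsify 10) (branch 2 4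
       (falsify 12) (falsify 11))) (falsify 13)) (falsify 13)) (branch 0 2 (falsify 10) (falsify 11))))))
       (branch 4 6 (branch 4 5 (falsify 4) (branch 2 5 (branch 2 6 (falsify 2) (branch 0 4 (falsify 10)
       (falsify 12))) (branch 1 2 (branch 1 4 (branch 3 4 (branch 0 2 (branch 0 1 (branch 3 5 (branch 2 3
       (falsify 13) (falsify 11)) (falsify 11)) (falsify 14)) (falsify 13)) (branch 0 1 (falsify 11)
       (falsify 12))) (branch 0 2 (falsify 10) (falsify 13))) (branch 0 4 (falsify 10) (falsify 13)))))
       (branch 2 5 (falsify 12) (branch 2 6 (branch 0 2 (falsify 10) (branch 4 5 (falsify 14) (falsify
       13))) (falsify 10)))))) (branch 2 5 (branch 2 6 (falsify 2) (branch 5 6 (falsify 7) (branch 4 5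
       (branch 3 5 (falsify 19) (branch 4 6 (falsify 4) (branch 3 4 (falsify 14) (falsify 12)))) (branch
       2 4 (branch 3 6 (branch 3 5 (falsify 3) (branch 2 3 (falsify 12) (falsify 14))) (falsify 12))
       (falsify 13))))) (branch 2 6 (branch 5 6 (falsify 7) (branch 3 6 (branch 3 5 (falsify 3) (branch 3
       4 (falsify 13) (falsify 12))) (branch 2 3 (branch 2 4 (falsify 12) (branch 1 4 (branch 0 4 (branch
       3 4 (falsify 13) (branch 3 5 (branch 4 6 (branch 4 5 (falsify 4) (falsify 12)) (falsify 13))
       (falsify 12))) (falsify 12)) (falsify 12))) (falsify 14)))) (branch 2 4 (branch 2 3 (falsify 12)
       (falsify 14)) (falsify 13))))))))
      tt
  indexedConfiguration-unsatisfiable₇ 6 _ refl = refutation-unsatisfiable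
      (branch 0 6 (falsify 0) (branch 1 6 (falsify 1) (branch 2 6 (falsify 2) (branch 3 6 (falsify 3)
       (branch 4 6 (falsify 4) (falsify 17))))))
      tt
  indexedConfiguration-unsatisfiable₇ 7 _ refl = refutation-unsatisfiable
      (falsify 0)
      tt
  indexedConfiguration-unsatisfiable₇ (suc (suc (suc (suc (suc (suc (suc (suc (_))))))))) _ ()

  Is3∨5∨7 : ℕ → Set
  Is3∨5∨7 d = d ≡ 3 ⊎ d ≡ 5 ⊎ d ≡ 7

  indexedConfiguration-unsatisfiable : ∀ p q → Is3∨5∨7 (p + q) →
    Unsatisfiable (indexedConfiguration p q)
  indexedConfiguration-unsatisfiable p q (inj₁ e)        = indexedConfiguration-unsatisfiable₃ p q e
  indexedConfiguration-unsatisfiable p q (inj₂ (inj₁ e)) = indexedConfiguration-unsatisfiable₅ p q e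
  indexedConfiguration-unsatisfiable p q (inj₂ (inj₂ e)) = indexedConfiguration-unsatisfiable₇ p q e

module CriticalGraphs where
  open Finite
  open Encoding
  open Refutations
  open import Data.Nat using (ℕ; _+_; _≤_; s≤s)
  open import Data.Nat.Properties using (≤-trans; ≤-reflexive; <-irrefl; +-cancelˡ-≡; ≤-pred)
  open import Data.Fin using (Fin; _≟_)
  open import Data.Fin.Subset using (Subset; ⁅_⁆; _∪_; ∣_∣) renaming (_∈_ to _∈ₛ_)
  open import Data.Fin.Subset.Properties using (x∈⁅x⁆; x∈p∪q⁺; ∣⁅x⁆∣≡1)
  open import Data.List using (List; _++_; length; filter; allFin; upTo; applyUpTo)
  open import Data.List.Properties using (filter-notAll; length-tabulate)
  open import Data.List.Relation.Unary.Any using (Any)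
  open import Data.List.Membership.Propositional using (_∈_; lose)
  open import Data.List.Membership.Propositional.Properties using (∈-filter⁺; ∈-filter⁻; ∈-allFin)
  open import Data.List.Relation.Unary.Unique.Propositional using (Unique)
  open import Data.List.Relation.Unary.Unique.Propositional.Properties using (allFin⁺; filter⁺)
  open import Data.Product using (_×_; _,_; ∃; ∃₂; proj₁; proj₂)
  import Data.Sum
  open import Data.Sum using (_⊎_; inj₁; inj₂)
  open import Data.Empty using (⊥; ⊥-elim)
  open import Function using (_∘_)
  open import Relation.Binary using (Decidable)
  open import Relation.Nullary using (¬_; ¬?; yes; no)
  open import Relation.Binary.PropositionalEquality as ≡ using (_≡_; _≢_; refl; subst)

  swap₁₂ : ∀ {A B C : Set} → A ⊎ B ⊎ C → B ⊎ A ⊎ C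
  swap₁₂ (inj₁ a)        = inj₂ (inj₁ a)
  swap₁₂ (inj₂ (inj₁ b)) = inj₁ b
  swap₁₂ (inj₂ (inj₂ c)) = inj₂ (inj₂ c)

  swap₂₃ : ∀ {A B C : Set} → A ⊎ B ⊎ C → A ⊎ C ⊎ B
  swap₂₃ = Data.Sum.map₂ Data.Sum.swap

  swap₁₃ : ∀ {A B C : Set} → A ⊎ B ⊎ C → C ⊎ B ⊎ A
  swap₁₃ = swap₁₂ ∘ swap₂₃ ∘ swap₁₂

  module _ {n : ℕ} (G : Graph n) (critical : Critical G 4) (δ≥2 : MinDegreeAtLeast G 2) where

    infix 4 _~_ _~?_
    _~_ : Fin n → Fin n → Set
    _~_ = Adj G

    _~?_ : Decidable _~_
    _~?_ = adj? G

    ~-sym : ∀ {v w} → v ~ w → w ~ v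
    ~-sym = sym G

    ~-irrefl : ∀ {v} → ¬ v ~ v
    ~-irrefl = irrefl G

    ~⇒≢ : ∀ {v w} → v ~ w → w ≢ v
    ~⇒≢ v~w refl = ~-irrefl v~w

    neighbour : ∀ v → ∃ (v ~_)
    neighbour = proj₁ critical

    adjacent-to-one : ∀ {w s s₁ s₂ s₃} → w ~ s → s ∈₃ (s₁ , s₂ , s₃) → w ~ s₁ ⊎ w ~ s₂ ⊎ w ~ s₃
    adjacent-to-one w~s (inj₁ refl)        = inj₁ w~s
    adjacent-to-one w~s (inj₂ (inj₁ refl)) = inj₂ (inj₁ w~s)
    adjacent-to-one w~s (inj₂ (inj₂ refl)) = inj₂ (inj₂ w~s)

    no-small-TDS : ∀ S → IsTDS G S → ¬ ∣ S ∣ ≤ 3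
    no-small-TDS S total ∣S∣≤3 = <-irrefl refl (≤-trans (γt≥4 S total) ∣S∣≤3)
      where
      γt≥4 : ∀ S → IsTDS G S → 4 ≤ ∣ S ∣
      γt≥4 = proj₂ (proj₁ (proj₂ critical))

    ¬dominates₃ : ∀ x y z → ¬ (∀ w → w ~ x ⊎ w ~ y ⊎ w ~ z)
    ¬dominates₃ x y z dominates = no-small-TDS S total ∣S∣≤3
      where
      S : Subset n
      S = ⁅ x ⁆ ∪ (⁅ y ⁆ ∪ ⁅ z ⁆)
      ∣S∣≤3 : ∣ S ∣ ≤ 3
      ∣S∣≤3 = ≤-trans (∣⁅x⁆∪p∣≤1+∣p∣ x _)
                (s≤s (≤-trans (∣⁅x⁆∪p∣≤1+∣p∣ y _) (s≤s (≤-reflexive (∣⁅x⁆∣≡1 z)))))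
      total : IsTDS G S
      total w with dominates w
      ... | inj₁ w~x        = x , x∈p∪q⁺ (inj₁ (x∈⁅x⁆ x)) , w~x
      ... | inj₂ (inj₁ w~y) = y , x∈p∪q⁺ (inj₂ (x∈p∪q⁺ (inj₁ (x∈⁅x⁆ y)))) , w~y
      ... | inj₂ (inj₂ w~z) = z , x∈p∪q⁺ (inj₂ (x∈p∪q⁺ (inj₂ (x∈⁅x⁆ z)))) , w~z

    no-leaf-neighbour : ∀ v → ¬ ∃ λ u → v ~ u × Leaf G u
    no-leaf-neighbour v (u , _ , deg≡1) with subst (2 ≤_) deg≡1 (δ≥2 u)
    ... | s≤s ()

    record DominatesMinus (v s₁ s₂ s₃ : Fin n) : Set where
      field
        nonadjacent : ∀ {s} → s ∈₃ (s₁ , s₂ , s₃) → ¬ v ~ s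
        distinct    : ∀ {s} → s ∈₃ (s₁ , s₂ , s₃) → s ≢ v
        dominates   : ∀ {w} → w ≢ v → w ~ s₁ ⊎ w ~ s₂ ⊎ w ~ s₃

    module _ {v s₁ s₂ s₃} (D : DominatesMinus v s₁ s₂ s₃) where
      open DominatesMinus D

      DominatesMinus-swap₁₂ : DominatesMinus v s₂ s₁ s₃
      DominatesMinus-swap₁₂ = record { nonadjacent = nonadjacent ∘ swap₁₂ ; distinct = distinct ∘ swap₁₂
                                     ; dominates = swap₁₂ ∘ dominates }

      DominatesMinus-swap₂₃ : DominatesMinus v s₁ s₃ s₂
      DominatesMinus-swap₂₃ = record { nonadjacent = nonadjacent ∘ swap₂₃ ; distinct = distinct ∘ swap₂₃
                                     ; dominates = swap₂₃ ∘ dominates }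

    DominatesMinus-swap₁₃ : ∀ {v s₁ s₂ s₃} → DominatesMinus v s₁ s₂ s₃ → DominatesMinus v s₃ s₂ s₁
    DominatesMinus-swap₁₃ = DominatesMinus-swap₁₂ ∘ DominatesMinus-swap₂₃ ∘ DominatesMinus-swap₁₂

    critical-triple : ∀ v → ∃₂ λ s₁ s₂ → ∃ (DominatesMinus v s₁ s₂)
    critical-triple v with proj₂ (proj₂ critical) v (no-leaf-neighbour v)
    ... | S , (v∉S , dominatesS) , ∣S∣<4 =
      s₁ , s₂ , s₃ , record
        { nonadjacent = outside-N[v] ∘ ∈-elements⁻ ∘ members
        ; distinct    = λ s∈ → λ { refl → v∉S (∈-elements⁻ (members s∈)) }
        ; dominates   = dominates }
      where
      outside-N[v] : ∀ {s} → s ∈ₛ S → ¬ v ~ s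
      outside-N[v] s∈S v~s = no-small-TDS S total (≤-pred ∣S∣<4)
        where
        total : IsTDS G S
        total w with w ≟ v
        ... | yes refl = _ , s∈S , v~s
        ... | no w≢v   = dominatesS w w≢v
      nonempty : ∃ (_∈ elements S)
      nonempty with dominatesS (proj₁ (neighbour v)) (~⇒≢ (proj₂ (neighbour v)))
      ... | s , s∈S , _ = s , ∈-elements⁺ s∈S
      open Cover₃ (short-list-cover₃ (elements S)
        (≤-trans (≤-reflexive (length-elements S)) (≤-pred ∣S∣<4)) (proj₂ nonempty))
      dominates : ∀ {w} → w ≢ v → w ~ s₁ ⊎ w ~ s₂ ⊎ w ~ s₃
      dominates w≢v with dominatesS _ w≢v
      ... | s , s∈S , w~s = adjacent-to-one w~s (covers (∈-elements⁺ s∈S))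

    record Outside (u a b c : Fin n) : Set where
      field
        nonadjacent : ∀ {s} → s ∈₃ (a , b , c) → ¬ u ~ s
        distinct    : ∀ {s} → s ∈₃ (a , b , c) → s ≢ u
        covers      : ∀ {w} → w ≢ u → ¬ u ~ w → w ∈₃ (a , b , c)

    data Location (u a b c : Fin n) : Fin n → Set where
      at-u    : Location u a b c u
      in-N[u] : ∀ {w} → u ~ w → Location u a b c w
      at-a    : Location u a b c a
      at-b    : Location u a b c b
      at-c    : Location u a b c c

    module _ {u a b c} (O : Outside u a b c) where
      open Outside O

      Outside-swap₁₂ : Outside u b a c
      Outside-swap₁₂ = record { nonadjacent = nonadjacent ∘ swap₁₂ ; distinct = distinct ∘ swap₁₂
                              ; covers = λ w≢u u≁w → swap₁₂ (covers w≢u u≁w) }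

      Outside-swap₂₃ : Outside u a c b
      Outside-swap₂₃ = record { nonadjacent = nonadjacent ∘ swap₂₃ ; distinct = distinct ∘ swap₂₃
                              ; covers = λ w≢u u≁w → swap₂₃ (covers w≢u u≁w) }

      locate : ∀ w → Location u a b c w
      locate w with w ≟ u | u ~? w
      ... | yes refl | _       = at-u
      ... | no _     | yes u~w = in-N[u] u~w
      ... | no w≢u   | no u≁w  with covers w≢u u≁w
      ...   | inj₁ refl        = at-a
      ...   | inj₂ (inj₁ refl) = at-b
      ...   | inj₂ (inj₂ refl) = at-c

      triple-outside : ∀ {s₁ s₂ s₃} → DominatesMinus u s₁ s₂ s₃ →
        ∀ {s} → s ∈₃ (s₁ , s₂ , s₃) → s ∈₃ (a , b , c)
      triple-outside D s∈ = covers (DominatesMinus.distinct D s∈) (DominatesMinus.nonadjacent D s∈)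

      outside-dominates : ∀ {w} → w ≢ u → w ~ a ⊎ w ~ b ⊎ w ~ c
      outside-dominates w≢u with critical-triple u
      ... | _ , _ , _ , D with DominatesMinus.dominates D w≢u
      ... | inj₁ w~s        = adjacent-to-one w~s (triple-outside D (inj₁ refl))
      ... | inj₂ (inj₁ w~s) = adjacent-to-one w~s (triple-outside D (inj₂ (inj₁ refl)))
      ... | inj₂ (inj₂ w~s) = adjacent-to-one w~s (triple-outside D (inj₂ (inj₂ refl)))

      no-hub : ∀ {x} → u ~ x → x ~ a → a ~ b → a ~ c → ⊥
      no-hub {x} u~x x~a a~b a~c = ¬dominates₃ u x a dominates
        where
        dominates : ∀ w → w ~ u ⊎ w ~ x ⊎ w ~ a
        dominates w with locate w
        ... | at-u        = inj₂ (inj₁ u~x)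
        ... | in-N[u] u~w = inj₁ (~-sym u~w)
        ... | at-a        = inj₂ (inj₁ (~-sym x~a))
        ... | at-b        = inj₂ (inj₂ (~-sym a~b))
        ... | at-c        = inj₂ (inj₂ (~-sym a~c))

      no-double-neighbour : ∀ {x} → u ~ x → x ~ a → x ~ b → ⊥
      no-double-neighbour {x} u~x x~a x~b = ¬dominates₃ u x t dominates
        where
        t : Fin n
        t = proj₁ (neighbour c)
        dominates : ∀ w → w ~ u ⊎ w ~ x ⊎ w ~ t
        dominates w with locate w
        ... | at-u        = inj₂ (inj₁ u~x)
        ... | in-N[u] u~w = inj₁ (~-sym u~w)
        ... | at-a        = inj₂ (inj₁ (~-sym x~a))
        ... | at-b        = inj₂ (inj₁ (~-sym x~b))
        ... | at-c        = inj₂ (inj₂ (proj₂ (neighbour c)))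

      no-isolated : ¬ c ~ a → ¬ c ~ b → ⊥
      no-isolated c≁a c≁b with outside-dominates (distinct (inj₂ (inj₂ refl)))
      ... | inj₁ c~a        = c≁a c~a
      ... | inj₂ (inj₁ c~b) = c≁b c~b
      ... | inj₂ (inj₂ c~c) = ~-irrefl c~c

    Outside-swap₁₃ : ∀ {u a b c} → Outside u a b c → Outside u c b a
    Outside-swap₁₃ = Outside-swap₁₂ ∘ Outside-swap₂₃ ∘ Outside-swap₁₂

    no-triangle : ∀ {u a b c} → Outside u a b c → a ~ b → b ~ c → a ~ c → ⊥
    no-triangle {u} O a~b b~c a~c with neighbour u
    ... | x , u~x with outside-dominates O (~⇒≢ u~x)
    ... | inj₁ x~a        = no-hub O u~x x~a a~b a~c
    ... | inj₂ (inj₁ x~b) = no-hub (Outside-swap₁₂ O) u~x x~b (~-sym a~b) b~c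
    ... | inj₂ (inj₂ x~c) = no-hub (Outside-swap₁₃ O) u~x x~c (~-sym b~c) (~-sym a~c)

    record Configuration (u : Fin n) : Set where
      field
        {a b c} : Fin n
        outside : Outside u a b c
        a~b     : a ~ b
        b~c     : b ~ c
        a≁c     : ¬ a ~ c

    reverse : ∀ {u} → Configuration u → Configuration u
    reverse K = record { outside = Outside-swap₁₃ outside ; a~b = ~-sym b~c ; b~c = ~-sym a~b
                       ; a≁c = a≁c ∘ ~-sym }
      where open Configuration K

    configuration : ∀ {u a b c} → Outside u a b c → Configuration u
    configuration {a = a} {b} {c} O with a ~? b | b ~? c | a ~? c
    ... | yes a~b | yes b~c | yes a~c = ⊥-elim (no-triangle O a~b b~c a~c)
    ... | yes a~b | yes b~c | no a≁c  = record { outside = O ; a~b = a~b ; b~c = b~c ; a≁c = a≁c }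
    ... | yes a~b | no b≁c  | yes a~c =
      record { outside = Outside-swap₁₂ O ; a~b = ~-sym a~b ; b~c = a~c ; a≁c = b≁c }
    ... | no a≁b  | yes b~c | yes a~c =
      record { outside = Outside-swap₂₃ O ; a~b = a~c ; b~c = ~-sym b~c ; a≁c = a≁b }
    ... | yes a~b | no b≁c  | no a≁c  = ⊥-elim (no-isolated O (a≁c ∘ ~-sym) (b≁c ∘ ~-sym))
    ... | no a≁b  | no b≁c  | yes a~c = ⊥-elim (no-isolated (Outside-swap₂₃ O) (a≁b ∘ ~-sym) b≁c)
    ... | no a≁b  | _       | no a≁c  = ⊥-elim (no-isolated (Outside-swap₁₃ O) a≁c a≁b)

    module ConfigurationLemmas {u} (K : Configuration u) where
      open Configuration K public

      A C : Fin n → Set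
      A x = u ~ x × x ~ a
      C x = u ~ x × x ~ c

      N[u]-≁b : ∀ {x} → u ~ x → ¬ x ~ b
      N[u]-≁b u~x x~b = no-hub (Outside-swap₁₂ outside) u~x x~b (~-sym a~b) b~c

      N[u]-split : ∀ {x} → u ~ x → x ~ a ⊎ x ~ c
      N[u]-split u~x with outside-dominates outside (~⇒≢ u~x)
      ... | inj₁ x~a        = inj₁ x~a
      ... | inj₂ (inj₁ x~b) = ⊥-elim (N[u]-≁b u~x x~b)
      ... | inj₂ (inj₂ x~c) = inj₂ x~c

      N[u]-disjoint : ∀ {x} → u ~ x → x ~ a → ¬ x ~ c
      N[u]-disjoint = no-double-neighbour (Outside-swap₂₃ outside)

      N[b] : ∀ {w} → w ~ b → w ≡ a ⊎ w ≡ c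
      N[b] {w} w~b with locate outside w
      ... | at-u        = ⊥-elim (Outside.nonadjacent outside (inj₂ (inj₁ refl)) w~b)
      ... | in-N[u] u~w = ⊥-elim (N[u]-≁b u~w w~b)
      ... | at-a        = inj₁ refl
      ... | at-b        = ⊥-elim (~-irrefl w~b)
      ... | at-c        = inj₂ refl

      N[a] : ∀ {w} → w ~ a → w ≡ b ⊎ u ~ w
      N[a] {w} w~a with locate outside w
      ... | at-u        = ⊥-elim (Outside.nonadjacent outside (inj₁ refl) w~a)
      ... | in-N[u] u~w = inj₂ u~w
      ... | at-a        = ⊥-elim (~-irrefl w~a)
      ... | at-b        = inj₁ refl
      ... | at-c        = ⊥-elim (a≁c (~-sym w~a))

    module _ {u} (K : Configuration u) where
      open ConfigurationLemmas K
      open DominatesMinus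

      N[c] : ∀ {w} → w ~ c → w ≡ b ⊎ u ~ w
      N[c] = ConfigurationLemmas.N[a] (reverse K)

      u≁ : ∀ {s} → s ∈₃ (a , b , c) → ¬ u ~ s
      u≁ = Outside.nonadjacent outside

      ≢-A : ∀ {x s} → A x → s ∈₃ (a , b , c) → s ≢ x
      ≢-A (u~x , _) s∈ refl = u≁ s∈ u~x

      -- The only neighbours of b are a ∈ N(x) and c.
      c-dominator : ∀ {x} → A x → ∃₂ λ t t′ → DominatesMinus x c t t′
      c-dominator {x} Ax with critical-triple x
      ... | s₁ , s₂ , s₃ , D with dominates D (≢-A Ax (inj₂ (inj₁ refl)))
      ... | inj₁ b~s₁ with N[b] (~-sym b~s₁)
      ...   | inj₁ refl = ⊥-elim (nonadjacent D (inj₁ refl) (proj₂ Ax))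
      ...   | inj₂ refl = s₂ , s₃ , D
      c-dominator Ax | s₁ , s₂ , s₃ , D | inj₂ (inj₁ b~s₂) with N[b] (~-sym b~s₂)
      ...   | inj₁ refl = ⊥-elim (nonadjacent D (inj₂ (inj₁ refl)) (proj₂ Ax))
      ...   | inj₂ refl = s₁ , s₃ , DominatesMinus-swap₁₂ D
      c-dominator Ax | s₁ , s₂ , s₃ , D | inj₂ (inj₂ b~s₃) with N[b] (~-sym b~s₃)
      ...   | inj₁ refl = ⊥-elim (nonadjacent D (inj₂ (inj₂ refl)) (proj₂ Ax))
      ...   | inj₂ refl = s₂ , s₁ , DominatesMinus-swap₁₃ D

      a-dominator : ∀ {x t t′} → A x → DominatesMinus x c t t′ →
        ∃₂ λ t t′ → DominatesMinus x c t t′ × t ~ a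
      a-dominator Ax D with dominates D (≢-A Ax (inj₁ refl))
      ... | inj₁ a~c         = ⊥-elim (a≁c a~c)
      ... | inj₂ (inj₁ a~t)  = _ , _ , D , ~-sym a~t
      ... | inj₂ (inj₂ a~t′) = _ , _ , DominatesMinus-swap₂₃ D , ~-sym a~t′

      partner-via-b : ∀ {x t′} → A x → DominatesMinus x c b t′ → Partner _~_ A C x
      partner-via-b {x} {t′} Ax@(u~x , _) D with dominates D (≡.≢-sym (~⇒≢ u~x))
      ... | inj₁ u~c         = ⊥-elim (u≁ (inj₂ (inj₂ refl)) u~c)
      ... | inj₂ (inj₁ u~b)  = ⊥-elim (u≁ (inj₂ (inj₁ refl)) u~b)
      ... | inj₂ (inj₂ u~t′) with dominates D (distinct D (inj₂ (inj₂ refl)))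
      ...   | inj₁ t′~c         =
        alone (u~t′ , t′~c) (nonadjacent D (inj₂ (inj₂ refl))) adjacent-to-t′
        where
        adjacent-to-t′ : ∀ {z} → A z → z ≢ x → z ~ t′
        adjacent-to-t′ (u~z , z~a) z≢x with dominates D z≢x
        ... | inj₁ z~c        = ⊥-elim (N[u]-disjoint u~z z~a z~c)
        ... | inj₂ (inj₁ z~b) = ⊥-elim (N[u]-≁b u~z z~b)
        ... | inj₂ (inj₂ z~t′) = z~t′
      ...   | inj₂ (inj₁ t′~b)  = ⊥-elim (N[u]-≁b u~t′ t′~b)
      ...   | inj₂ (inj₂ t′~t′) = ⊥-elim (~-irrefl t′~t′)

      partner-via-A : ∀ {x t t′} → A x → DominatesMinus x c t t′ → A t → Partner _~_ A C x
      partner-via-A {x} {t} {t′} Ax D (u~t , t~a) with dominates D (≢-A Ax (inj₂ (inj₂ refl)))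
      ... | inj₁ c~c         = ⊥-elim (~-irrefl c~c)
      ... | inj₂ (inj₁ c~t)  = ⊥-elim (N[u]-disjoint u~t t~a (~-sym c~t))
      ... | inj₂ (inj₂ c~t′) with N[c] (~-sym c~t′) | dominates D (distinct D (inj₂ (inj₁ refl)))
      ...   | _         | inj₁ t~c         = ⊥-elim (N[u]-disjoint u~t t~a t~c)
      ...   | _         | inj₂ (inj₁ t~t)  = ⊥-elim (~-irrefl t~t)
      ...   | inj₁ refl | inj₂ (inj₂ t~b)  = ⊥-elim (N[u]-≁b u~t t~b)
      ...   | inj₂ u~t′ | inj₂ (inj₂ t~t′) =
        via (u~t′ , ~-sym c~t′) (nonadjacent D (inj₂ (inj₂ refl))) (u~t , t~a)
            (distinct D (inj₂ (inj₁ refl))) t~t′ (nonadjacent D (inj₂ (inj₁ refl)) ∘ ~-sym)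
            adjacent-to-t⊎t′
        where
        adjacent-to-t⊎t′ : ∀ {z} → A z → z ≢ x → z ~ t ⊎ z ~ t′
        adjacent-to-t⊎t′ (u~z , z~a) z≢x with dominates D z≢x
        ... | inj₁ z~c = ⊥-elim (N[u]-disjoint u~z z~a z~c)
        ... | inj₂ z~t⊎t′ = z~t⊎t′

      partner : ∀ {x} → A x → Partner _~_ A C x
      partner Ax with c-dominator Ax
      ... | _ , _ , D with a-dominator Ax D
      ... | t , _ , D′ , t~a with N[a] t~a
      ...   | inj₁ refl = partner-via-b Ax D′
      ...   | inj₂ u~t  = partner-via-A Ax D′ (u~t , t~a)

      has-non-neighbour : ∀ {x} → A x → ¬ (∀ {y} → C y → x ~ y)
      has-non-neighbour {x} (u~x , _) x~C = ¬dominates₃ a b x dominating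
        where
        dominating : ∀ w → w ~ a ⊎ w ~ b ⊎ w ~ x
        dominating w with locate outside w
        ... | at-u        = inj₂ (inj₂ u~x)
        ... | at-a        = inj₂ (inj₁ a~b)
        ... | at-b        = inj₁ (~-sym a~b)
        ... | at-c        = inj₂ (inj₁ (~-sym b~c))
        ... | in-N[u] u~w with N[u]-split u~w
        ...   | inj₁ w~a = inj₁ w~a
        ...   | inj₂ w~c = inj₂ (inj₂ (~-sym (x~C (u~w , w~c))))

      edge-escapes : ∀ {x y} → A x → C y → x ~ y → ¬ (∀ {z} → C z → z ≢ y → z ~ x ⊎ z ~ y)
      edge-escapes {x} {y} (u~x , x~a) (_ , y~c) x~y C∖y~x⊎y = ¬dominates₃ a x y dominating
        where
        dominating : ∀ w → w ~ a ⊎ w ~ x ⊎ w ~ y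
        dominating w with locate outside w
        ... | at-u        = inj₂ (inj₁ u~x)
        ... | at-a        = inj₂ (inj₁ (~-sym x~a))
        ... | at-b        = inj₁ (~-sym a~b)
        ... | at-c        = inj₂ (inj₂ (~-sym y~c))
        ... | in-N[u] u~w with N[u]-split u~w | w ≟ y
        ...   | inj₁ w~a | _        = inj₁ w~a
        ...   | inj₂ _   | yes refl = inj₂ (inj₁ (~-sym x~y))
        ...   | inj₂ w~c | no w≢y   = inj₂ (C∖y~x⊎y (u~w , w~c) w≢y)

      constraints : Constraints _~_ A C
      constraints = record
        { has-non-neighbour = has-non-neighbour
        ; edge-escapes      = edge-escapes
        ; has-partner       = partner
        }

    outside-of : ∀ u → n ≡ degree G u + 4 → ∃₂ λ a b → ∃ (Outside u a b)
    outside-of u n≡deg+4 = s₁ , s₂ , s₃ , record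
      { nonadjacent = non-neighbours⁻ ∘ proj₁ ∘ others⁻ ∘ members
      ; distinct    = proj₂ ∘ others⁻ ∘ members
      ; covers      = λ w≢u u≁w → covers (others⁺ w≢u u≁w)
      }
      where
      non-neighbours others : List (Fin n)
      non-neighbours = filter (λ w → ¬? (u ~? w)) (allFin n)
      others         = filter (λ w → ¬? (w ≟ u)) non-neighbours

      non-neighbours⁻ : ∀ {w} → w ∈ non-neighbours → ¬ u ~ w
      non-neighbours⁻ = proj₂ ∘ ∈-filter⁻ (λ w → ¬? (u ~? w)) {xs = allFin n}

      others⁻ : ∀ {w} → w ∈ others → w ∈ non-neighbours × w ≢ u
      others⁻ = ∈-filter⁻ (λ w → ¬? (w ≟ u))

      others⁺ : ∀ {w} → w ≢ u → ¬ u ~ w → w ∈ others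
      others⁺ w≢u u≁w = ∈-filter⁺ _ (∈-filter⁺ _ (∈-allFin _) u≁w) w≢u

      length-non-neighbours : length non-neighbours ≡ 4
      length-non-neighbours = +-cancelˡ-≡ (degree G u) _ _
        (≡.trans (length-filter-∁ (u ~?_) (allFin n)) (≡.trans (length-tabulate (λ w → w)) n≡deg+4))

      length-others : length others ≤ 3
      length-others = ≤-pred (≤-trans (filter-notAll (λ w → ¬? (w ≟ u)) non-neighbours u-removed)
                                      (≤-reflexive length-non-neighbours))
        where
        u-removed : Any (λ w → ¬ ¬ w ≡ u) non-neighbours
        u-removed = lose (∈-filter⁺ _ (∈-allFin u) ~-irrefl) λ u≢u → u≢u refl

      some-other : ∃ (_∈ others)
      some-other with critical-triple u
      ... | s , _ , _ , D =
        s , others⁺ (DominatesMinus.distinct D (inj₁ refl)) (DominatesMinus.nonadjacent D (inj₁ refl))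

      open Cover₃ (short-list-cover₃ others length-others (proj₂ some-other))

    no-configuration : ∀ {u} → Configuration u → ¬ Is3∨5∨7 (degree G u)
    no-configuration {u} K deg∈357 =
      indexedConfiguration-unsatisfiable p q (≡.subst Is3∨5∨7 (≡.sym p+q≡deg) deg∈357)
        ρ (ρ-symmetric ~-sym)
        (satisfies (configurationFormulas-hold (constraints K) (constraints (reverse K)) enumA enumC))
      where
      open ConfigurationLemmas K using (a; A; C; N[u]-split; N[u]-disjoint)
      N[u] NA NC : List (Fin n)
      N[u] = filter (u ~?_) (allFin n)
      NA   = filter (_~? a) N[u]
      NC   = filter (λ z → ¬? (z ~? a)) N[u]

      p q : ℕ
      p = length NA
      q = length NC

      p+q≡deg : p + q ≡ degree G u
      p+q≡deg = length-filter-∁ (_~? a) N[u]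

      -- Index i < p + q stands for the i-th vertex of NA ++ NC; the default u is never used.
      open Soundness _~?_ (lookupOr u (NA ++ NC))

      unique-N[u] : Unique N[u]
      unique-N[u] = filter⁺ (u ~?_) (allFin⁺ n)

      ∈N[u]⁻ : ∀ {z} → z ∈ N[u] → u ~ z
      ∈N[u]⁻ = proj₂ ∘ ∈-filter⁻ (u ~?_) {xs = allFin n}

      ∈N[u]⁺ : ∀ {z} → u ~ z → z ∈ N[u]
      ∈N[u]⁺ = ∈-filter⁺ (u ~?_) (∈-allFin _)

      ∈NA⇒A : ∀ {z} → z ∈ NA → A z
      ∈NA⇒A z∈NA = let z∈N , z~a = ∈-filter⁻ (_~? a) z∈NA in ∈N[u]⁻ z∈N , z~a

      A⇒∈NA : ∀ {z} → A z → z ∈ NA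
      A⇒∈NA (u~z , z~a) = ∈-filter⁺ (_~? a) (∈N[u]⁺ u~z) z~a

      ∈NC⇒C : ∀ {z} → z ∈ NC → C z
      ∈NC⇒C z∈NC with ∈-filter⁻ (λ z → ¬? (z ~? a)) z∈NC
      ... | z∈N , z≁a with N[u]-split (∈N[u]⁻ z∈N)
      ...   | inj₁ z~a = ⊥-elim (z≁a z~a)
      ...   | inj₂ z~c = ∈N[u]⁻ z∈N , z~c

      C⇒∈NC : ∀ {z} → C z → z ∈ NC
      C⇒∈NC (u~z , z~c) = ∈-filter⁺ (λ z → ¬? (z ~? a)) (∈N[u]⁺ u~z) λ z~a → N[u]-disjoint u~z z~a z~c

      enumA : Enumerates A (upTo p)
      enumA = enumerates-via-map (map-lookupOr-prefix u NA NC) (filter⁺ (_~? a) unique-N[u]) ∈NA⇒A A⇒∈NA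

      enumC : Enumerates C (applyUpTo (p +_) q)
      enumC = enumerates-via-map (map-lookupOr-suffix u NA NC) (filter⁺ (λ z → ¬? (z ~? a)) unique-N[u])
        ∈NC⇒C C⇒∈NC

    no-vertex-of-degree-3∨5∨7 : ∀ u → n ≡ degree G u + 4 → ¬ Is3∨5∨7 (degree G u)
    no-vertex-of-degree-3∨5∨7 u n≡deg+4 with outside-of u n≡deg+4
    ... | _ , _ , _ , O = no-configuration (configuration O)

open CriticalGraphs
open Refutations using (Is3∨5∨7)

theorem10 : (D : ℕ) → (D ≡ 3 ⊎ D ≡ 5 ⊎ D ≡ 7) → (G : Graph (D + 4)) →
    ¬ (Critical G 4 × MaxDegree G D × MinDegreeAtLeast G 2)
theorem10 D D∈357 G (critical , ((u , deg≡D) , _) , δ≥2) =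
  no-vertex-of-degree-3∨5∨7 G critical δ≥2 u (≡.cong (_+ 4) (≡.sym deg≡D))
    (≡.subst Is3∨5∨7 (≡.sym deg≡D) D∈357)
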